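{- Let $M$ and $M'$ be lists of integers (all entries at least $2$) and let $\lambda$, $n$ and $m\geq 3$ be positive integers. If there is an $(M)$-packing of $\lambda K_n$ whose leave has an $(M',m,2)$-flower as its only nontrivial connected component, then there is an $(M,3)$-packing of $\lambda K_n$ whose leave has an $(M',m-1)$-flower as its only nontrivial connected component.
   Context: Graphs may have multiple edges; $\lambda K_n$ is the complete multigraph on $n$ vertices with each pair of distinct vertices joined by $\lambda$ edges. For $m\geq 2$ an $m$-cycle has $m$ distinct vertices $v_1,\dots,v_m$ and edges $v_1v_2,\dots,v_mv_1$ (a $2$-cycle is two parallel edges). List notation: $(M,a,b,\ldots)$ is the list $M$ with entries $a,b,\ldots$ appended. For a list $M=(m_1,\ldots,m_t)$, if $K$ is a graph all of whose vertex degrees are even, an $(M)$-decomposition of $K$ is a partition of $E(K)$ into cycles $G_1,\ldots,G_t$ with $G_i$ an $m_i$-cycle; if all degrees of $K$ are odd, it is a partition of $E(K)$ into such cycles together with a perfect matching of $K$. An $(M)$-packing of $\lambda K_n$ is an $(M)$-decomposition of some subgraph $G$ of $\lambda K_n$ (spanning all $n$ vertices), where $G$ is required to have all degrees even if $\lambda(n-1)$ is even and all degrees odd if $\lambda(n-1)$ is odd; its leave is the graph $\lambda K_n-G$ (same vertex set, remaining edges). A graph is an $(a_1,\ldots,a_s)$-flower ($s\geq1$, each $a_i\geq 2$) if it is the union of cycles $A_1,\ldots,A_s$ with $A_i$ of length $a_i$ such that, if $s\geq2$, there is a vertex $x$ with $V(A_i)\cap V(A_j)=\{x\}$ for all $i<j$.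 A nontrivial connected component is one containing at least one edge. -}

module Defs where

open import Data.Nat using (ℕ; zero; suc; _+_; _*_; _∸_; _≤_)
open import Data.Nat.Divisibility using (_∣_)
open import Data.Fin using (Fin; _≟_)
open import Data.Bool using (Bool; true; false; if_then_else_; _∧_; _∨_)
open import Data.List using (List; []; _∷_; _++_; length; map; [_])
open import Data.List.Relation.Unary.All using (All)
open import Data.List.Relation.Unary.Unique.Propositional using (Unique)
open import Data.List.Relation.Unary.AllPairs using (AllPairs)
open import Data.List.Membership.Propositional using (_∈_)
open import Data.Product using (Σ; ∃; _×_; _,_)
open import Relation.Nullary using (¬_; ⌊_⌋)
open import Relation.Binary.PropositionalEquality using (_≡_; _≢_)
open import Function.Bundles using (_⇔_)

-- A multigraph on vertex set Fin n, given by edge multiplicities: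
-- G u v = number of edges joining u and v.
Graph : ℕ → Set
Graph n = Fin n → Fin n → ℕ

_⊕_ : ∀ {n} → Graph n → Graph n → Graph n
(G ⊕ H) u v = G u v + H u v

emptyG : ∀ {n} → Graph n
emptyG u v = 0

sumFin : ∀ {n} → (Fin n → ℕ) → ℕ
sumFin {zero} f = 0
sumFin {suc n} f = f Fin.zero + sumFin (λ i → f (Fin.suc i))

deg : ∀ {n} → Graph n → Fin n → ℕ
deg G u = sumFin (G u)

complete : (lam n : ℕ) → Graph n
complete lam n u v = if ⌊ u ≟ v ⌋ then 0 else lam

-- the graph consisting of a single edge ab (a ≠ b assumed where used)
edgeG : ∀ {n} → Fin n → Fin n → Graph n
edgeG a b u v =
  if (⌊ a ≟ u ⌋ ∧ ⌊ b ≟ v ⌋) ∨ (⌊ a ≟ v ⌋ ∧ ⌊ b ≟ u ⌋) then 1 else 0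

edgesG : ∀ {n} → List (Fin n × Fin n) → Graph n
edgesG [] = emptyG
edgesG ((a , b) ∷ es) = edgeG a b ⊕ edgesG es

cycEdgesFrom : ∀ {n} → Fin n → List (Fin n) → List (Fin n × Fin n)
cycEdgesFrom x0 [] = []
cycEdgesFrom x0 (a ∷ []) = (a , x0) ∷ []
cycEdgesFrom x0 (a ∷ b ∷ r) = (a , b) ∷ cycEdgesFrom x0 (b ∷ r)

cycEdges : ∀ {n} → List (Fin n) → List (Fin n × Fin n)
cycEdges [] = []
cycEdges (x ∷ xs) = cycEdgesFrom x (x ∷ xs)

-- A cycle is given by its list of vertices v1,...,vk (k ≥ 2, distinct).
IsCycle : ∀ {n} → List (Fin n) → Set
IsCycle c = (2 ≤ length c) × Unique c

cycleG : ∀ {n} → List (Fin n) → Graph n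
cycleG c = edgesG (cycEdges c)

cyclesG : ∀ {n} → List (List (Fin n)) → Graph n
cyclesG [] = emptyG
cyclesG (c ∷ cs) = cycleG c ⊕ cyclesG cs

CycleList : ∀ {n} → List ℕ → List (List (Fin n)) → Set
CycleList M cs = All IsCycle cs × map length cs ≡ M

IsPerfectMatching : ∀ {n} → List (Fin n × Fin n) → Set
IsPerfectMatching {n} es =
  All (λ e → Data.Product.proj₁ e ≢ Data.Product.proj₂ e) es ×
  (∀ (u : Fin n) → deg (edgesG es) u ≡ 1)

EvenDecomposition : ∀ {n} → List ℕ → Graph n → Set
EvenDecomposition {n} M K =
  Σ (List (List (Fin n))) λ cs → CycleList M cs × (∀ u v → K u v ≡ cyclesG cs u v)

OddDecomposition : ∀ {n} → List ℕ → Graph n → Set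
OddDecomposition {n} M K =
  Σ (List (List (Fin n))) λ cs → Σ (List (Fin n × Fin n)) λ P →
    CycleList M cs × IsPerfectMatching P ×
    (∀ u v → K u v ≡ cyclesG cs u v + edgesG P u v)

record Packing (lam n : ℕ) (M : List ℕ) : Set where
  field
    G        : Graph n
    subgraph : ∀ u v → G u v ≤ complete lam n u v
    parity   : (2 ∣ lam * (n ∸ 1) → (∀ u → 2 ∣ deg G u) × EvenDecomposition M G)
             × (¬ (2 ∣ lam * (n ∸ 1)) → (∀ u → ¬ (2 ∣ deg G u)) × OddDecomposition M G)

leave : ∀ {lam n M} → Packing lam n M → Graph n
leave {lam} {n} P u v = complete lam n u v ∸ Packing.G P u v

FlowerCycles : ∀ {n} → List (List (Fin n)) → Set
FlowerCycles {n} As =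
  All IsCycle As ×
  (2 ≤ length As →
    Σ (Fin n) λ x → AllPairs (λ A B → ∀ y → ((y ∈ A × y ∈ B) ⇔ (y ≡ x))) As)

IsFlowerG : ∀ {n} → List ℕ → Graph n → Set
IsFlowerG {n} a H =
  1 ≤ length a ×
  Σ (List (List (Fin n))) λ As →
    FlowerCycles As × map length As ≡ a × (∀ u v → H u v ≡ cyclesG As u v)

-- Since a flower is connected, this says exactly that the edge multiset
-- of L is that of an (a)-flower (all other components are isolated vertices).
OnlyNontrivialComponentIsFlower : ∀ {n} → List ℕ → Graph n → Set
OnlyNontrivialComponentIsFlower = IsFlowerG

{-# OPTIONS --safe #-}
-- Let x z be the digon of the leave and x p β q … its m-cycle, so that in the leave z is joined
-- only to x (twice) and β only to p and q. Swapping z and β on some segments of the cycles and of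
-- the perfect matching of the packing gives a new packing with the same cycle lengths, and moves
-- leave edges between z and β; each segment is recorded as a switch, a pair of signed ends.
-- Merging switches along opposite ends until none is left shows that the (z β)-degree difference
-- of the leave is realised by a single switch with ends among p, q, x. In each of its four shapes
-- the leave edges pβ, βq, xz, xz become pε, εx, xγ, γq with γ, ε ∈ {z, β}: the triangle x p ε
-- joins the packing and x γ q … is an (m − 1)-cycle of the new leave. For m = 3 the m-cycle
-- itself is the triangle.
module Submission where

open import Defs
open import Data.Nat using (ℕ; zero; suc; _+_; _*_; _∸_; _≤_; z≤n; s≤s)
open import Data.Nat.Properties using (m≤n⇒m<n∨m≡n; +-comm; +-assoc; +-identityʳ; +-cancelʳ-≡; +-cancelˡ-≡; ≤-refl; m+n∸m≡n; m+[n∸m]≡n; m≤m+n; m≤n+m; ≤-trans; ≤-reflexive; suc-injective; m+n≡0⇒m≡0; m+n≡0⇒n≡0; 0≢1+n)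
open import Data.Nat.Divisibility using (_∣_; _∣?_; divides; m∣m*n; ∣m∣n⇒∣m+n; ∣m+n∣m⇒∣n; ∣1⇒≡1)
open import Data.Nat.Tactic.RingSolver using (solve-∀)
open import Data.Bool using (Bool; true; false; if_then_else_; _∧_; _∨_)
open import Data.Bool.Properties using (∨-comm; ∧-comm; ∧-zeroʳ)
open import Data.Fin using (Fin; _≟_)
import Data.Fin as Fin
open import Data.List using (List; []; _∷_; _++_; length; map; [_]; reverse)
open import Data.List.Properties using (++-assoc; ++-identityʳ; unfold-reverse; map-++; map-∘; length-map; length-++; ∷-injective)
open import Data.Nat.ListAction using (sum)
open import Data.Nat.ListAction.Properties using (sum-++; sum-↭)
open import Data.List.Membership.Propositional using (_∈_; _∉_)
import Data.List.Membership.DecPropositional as DecMembership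
open import Data.List.Membership.Propositional.Properties using (∈-∃++; ∈-++⁻; ∈-++⁺ˡ; ∈-++⁺ʳ)
open import Data.List.Relation.Binary.Permutation.Propositional using (_↭_; ↭-refl; ↭-prep; ↭-swap; ↭-trans; ↭-sym; ↭⇒↭ₛ)
import Data.List.Relation.Binary.Permutation.Setoid.Properties as PermSetoid
open import Data.List.Relation.Binary.Permutation.Propositional.Properties using (++-comm; map⁺; All-resp-↭; ∈-resp-↭; ↭-length; ↭-reverse; shift) renaming (++⁺ to ++⁺↭)
open import Data.List.Relation.Unary.Any using (Any; here; there)
open import Data.List.Relation.Unary.All using (All; []; _∷_)
import Data.List.Relation.Unary.All as All
open import Data.List.Relation.Unary.All.Properties using (++⁺; ++⁻; All¬⇒¬Any; ¬Any⇒All¬) renaming (map⁺ to map⁺ᴬ)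
open import Data.List.Relation.Unary.Unique.Propositional using (Unique)
open import Data.List.Relation.Unary.AllPairs using (AllPairs; []; _∷_)
import Data.List.Relation.Unary.AllPairs as AllPairs
import Data.List.Relation.Unary.AllPairs.Properties as AllPairs
open import Data.Product using (Σ; ∃; _×_; _,_; proj₁; proj₂)
open import Data.Sum using (_⊎_; inj₁; inj₂)
open import Relation.Nullary using (¬_; ⌊_⌋; yes; no; Dec; contradiction)
open import Relation.Binary.PropositionalEquality hiding ([_])
open import Function using (_∘_; id)
open import Function.Bundles using (_⇔_; Equivalence; mk⇔)

-- Graphs, paths and cycles

infix 4 _≈G_
_≈G_ : ∀ {n} → Graph n → Graph n → Set
G ≈G H = ∀ u v → G u v ≡ H u v

≈G-sym : ∀ {n} {G H : Graph n} → G ≈G H → H ≈G G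
≈G-sym G≈H u v = sym (G≈H u v)

SymmetricG : ∀ {n} → Graph n → Set
SymmetricG G = ∀ u v → G u v ≡ G v u

⊕-sym : ∀ {n} {G H : Graph n} → SymmetricG G → SymmetricG H → SymmetricG (G ⊕ H)
⊕-sym G-sym H-sym u v = cong₂ _+_ (G-sym u v) (H-sym u v)

δ : ∀ {n} → Fin n → Fin n → ℕ
δ a b = if ⌊ a ≟ b ⌋ then 1 else 0

δ-refl : ∀ {n} (a : Fin n) → δ a a ≡ 1
δ-refl a with a ≟ a
... | yes _ = refl
... | no a≢a = contradiction refl a≢a

δ-≢ : ∀ {n} {a b : Fin n} → a ≢ b → δ a b ≡ 0
δ-≢ {a = a} {b} a≢b with a ≟ b
... | yes a≡b = contradiction a≡b a≢b
... | no _ = refl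

δ≡1⇒≡ : ∀ {n} {a b : Fin n} → δ a b ≡ 1 → a ≡ b
δ≡1⇒≡ {a = a} {b} eq with a ≟ b
... | yes a≡b = a≡b
δ≡1⇒≡ () | no _

edgeG-sym : ∀ {n} (a b : Fin n) → SymmetricG (edgeG a b)
edgeG-sym a b u v = cong (if_then 1 else 0) (∨-comm (⌊ a ≟ u ⌋ ∧ ⌊ b ≟ v ⌋) _)

edgeG-comm : ∀ {n} (a b : Fin n) → edgeG a b ≈G edgeG b a
edgeG-comm a b u v = cong (if_then 1 else 0)
  (trans (∨-comm (⌊ a ≟ u ⌋ ∧ ⌊ b ≟ v ⌋) _) (cong₂ _∨_ (∧-comm ⌊ a ≟ v ⌋ _) (∧-comm ⌊ a ≟ u ⌋ _)))

edgeG-atˡ : ∀ {n} {a b : Fin n} → a ≢ b → ∀ v → edgeG a b a v ≡ δ b v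
edgeG-atˡ {a = a} {b} a≢b v with a ≟ a | b ≟ a
... | no a≢a | _ = contradiction refl a≢a
... | yes _ | yes b≡a = contradiction (sym b≡a) a≢b
... | yes _ | no _ with b ≟ v | a ≟ v
...   | yes _ | _ = refl
...   | no _ | yes _ = refl
...   | no _ | no _ = refl

edgeG-atʳ : ∀ {n} {a b : Fin n} → a ≢ b → ∀ v → edgeG a b b v ≡ δ a v
edgeG-atʳ {a = a} {b} a≢b v = trans (edgeG-comm a b b v) (edgeG-atˡ (a≢b ∘ sym) v)

edgeG-off : ∀ {n} {a b u : Fin n} → u ≢ a → u ≢ b → ∀ v → edgeG a b u v ≡ 0
edgeG-off {a = a} {b} {u} u≢a u≢b v with a ≟ u | b ≟ u
... | yes a≡u | _ = contradiction (sym a≡u) u≢a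
... | no _ | yes b≡u = contradiction (sym b≡u) u≢b
... | no _ | no _ with a ≟ v
...   | yes _ = refl
...   | no _ = refl

edgeG-avoid : ∀ {n} {c a u v : Fin n} → u ≢ c → v ≢ c → edgeG c a u v ≡ 0
edgeG-avoid {c = c} {a} {u} {v} u≢c v≢c with c ≟ u | c ≟ v
... | yes c≡u | _ = contradiction (sym c≡u) u≢c
... | no _ | yes c≡v = contradiction (sym c≡v) v≢c
... | no _ | no _ = refl

edgesG-++ : ∀ {n} (es fs : List (Fin n × Fin n)) → edgesG (es ++ fs) ≈G (edgesG es ⊕ edgesG fs)
edgesG-++ [] fs u v = refl
edgesG-++ ((a , b) ∷ es) fs u v =
  trans (cong (edgeG a b u v +_) (edgesG-++ es fs u v)) (sym (+-assoc (edgeG a b u v) _ _))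

edgesG-sym : ∀ {n} (es : List (Fin n × Fin n)) → SymmetricG (edgesG es)
edgesG-sym [] u v = refl
edgesG-sym ((a , b) ∷ es) u v = cong₂ _+_ (edgeG-sym a b u v) (edgesG-sym es u v)

pathEdges : ∀ {A : Set} → List A → List (A × A)
pathEdges [] = []
pathEdges (a ∷ []) = []
pathEdges (a ∷ b ∷ r) = (a , b) ∷ pathEdges (b ∷ r)

pathG : ∀ {n} → List (Fin n) → Graph n
pathG l = edgesG (pathEdges l)

arcG : ∀ {n} → Fin n → List (Fin n) → Fin n → Graph n
arcG a P b = pathG (a ∷ P ++ [ b ])

lastOf : ∀ {A : Set} → A → List A → A
lastOf h [] = h
lastOf h (c ∷ P) = lastOf c P

lastOf-∈ : ∀ {A : Set} (h : A) (P : List A) → lastOf h P ∈ h ∷ P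
lastOf-∈ h [] = here refl
lastOf-∈ h (c ∷ P) = there (lastOf-∈ c P)

lastOf-++ : ∀ {A : Set} (h : A) (P : List A) (c : A) (Q : List A) → lastOf h (P ++ c ∷ Q) ≡ lastOf c Q
lastOf-++ h [] c Q = refl
lastOf-++ h (d ∷ P) c Q = lastOf-++ d P c Q

cycEdgesFrom-pathEdges : ∀ {n} (a : Fin n) (l : List (Fin n)) → cycEdgesFrom a l ≡ pathEdges (l ++ [ a ])
cycEdgesFrom-pathEdges a [] = refl
cycEdgesFrom-pathEdges a (b ∷ []) = refl
cycEdgesFrom-pathEdges a (b ∷ c ∷ r) = cong ((b , c) ∷_) (cycEdgesFrom-pathEdges a (c ∷ r))

cycleG-arcG : ∀ {n} (a : Fin n) (r : List (Fin n)) → cycleG (a ∷ r) ≈G arcG a r a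
cycleG-arcG a r u v = cong (λ es → edgesG es u v) (cycEdgesFrom-pathEdges a (a ∷ r))

pathEdges-++ : ∀ {A : Set} (xs : List A) (y : A) (ys : List A) →
  pathEdges (xs ++ y ∷ ys) ≡ pathEdges (xs ++ [ y ]) ++ pathEdges (y ∷ ys)
pathEdges-++ [] y ys = refl
pathEdges-++ (a ∷ []) y ys = refl
pathEdges-++ (a ∷ b ∷ xs) y ys = cong ((a , b) ∷_) (pathEdges-++ (b ∷ xs) y ys)

pathG-++ : ∀ {n} (xs : List (Fin n)) (y : Fin n) (ys : List (Fin n)) →
  pathG (xs ++ y ∷ ys) ≈G (pathG (xs ++ [ y ]) ⊕ pathG (y ∷ ys))
pathG-++ xs y ys u v =
  trans (cong (λ es → edgesG es u v) (pathEdges-++ xs y ys)) (edgesG-++ (pathEdges (xs ++ [ y ])) _ u v)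

cycleG-split : ∀ {n} (a : Fin n) (P₁ : List (Fin n)) (b : Fin n) (P₂ : List (Fin n)) →
  cycleG (a ∷ P₁ ++ b ∷ P₂) ≈G (arcG a P₁ b ⊕ arcG b P₂ a)
cycleG-split a P₁ b P₂ u v = begin
  cycleG (a ∷ P₁ ++ b ∷ P₂) u v                  ≡⟨ cycleG-arcG a (P₁ ++ b ∷ P₂) u v ⟩
  pathG (a ∷ (P₁ ++ b ∷ P₂) ++ [ a ]) u v        ≡⟨ cong (λ l → pathG (a ∷ l) u v) (++-assoc P₁ (b ∷ P₂) [ a ]) ⟩
  pathG ((a ∷ P₁) ++ b ∷ (P₂ ++ [ a ])) u v      ≡⟨ pathG-++ (a ∷ P₁) b (P₂ ++ [ a ]) u v ⟩
  arcG a P₁ b u v + arcG b P₂ a u v              ∎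
  where open ≡-Reasoning

cycleG-rotate₁ : ∀ {n} (a : Fin n) (r : List (Fin n)) → cycleG (a ∷ r) ≈G cycleG (r ++ [ a ])
cycleG-rotate₁ a [] u v = refl
cycleG-rotate₁ a (b ∷ r) u v = begin
  cycleG (a ∷ b ∷ r) u v                              ≡⟨ cycleG-arcG a (b ∷ r) u v ⟩
  edgeG a b u v + pathG (b ∷ r ++ [ a ]) u v          ≡⟨ trans (+-comm (edgeG a b u v) _) (cong (pathG (b ∷ r ++ [ a ]) u v +_) (sym (+-identityʳ _))) ⟩
  pathG (b ∷ r ++ [ a ]) u v + (edgeG a b u v + 0)    ≡⟨ pathG-++ (b ∷ r) a [ b ] u v ⟨
  pathG ((b ∷ r) ++ a ∷ [ b ]) u v                    ≡⟨ cong (λ l → pathG (b ∷ l) u v) (++-assoc r [ a ] [ b ]) ⟨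
  pathG (b ∷ (r ++ [ a ]) ++ [ b ]) u v               ≡⟨ cycleG-arcG b (r ++ [ a ]) u v ⟨
  cycleG ((b ∷ r) ++ [ a ]) u v                       ∎
  where open ≡-Reasoning

cycleG-rotate : ∀ {n} (xs ys : List (Fin n)) → cycleG (xs ++ ys) ≈G cycleG (ys ++ xs)
cycleG-rotate [] ys u v = cong (λ l → cycleG l u v) (sym (++-identityʳ ys))
cycleG-rotate (a ∷ xs) ys u v = begin
  cycleG (a ∷ xs ++ ys) u v         ≡⟨ cycleG-rotate₁ a (xs ++ ys) u v ⟩
  cycleG ((xs ++ ys) ++ [ a ]) u v  ≡⟨ cong (λ l → cycleG l u v) (++-assoc xs ys [ a ]) ⟩
  cycleG (xs ++ ys ++ [ a ]) u v    ≡⟨ cycleG-rotate xs (ys ++ [ a ]) u v ⟩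
  cycleG ((ys ++ [ a ]) ++ xs) u v  ≡⟨ cong (λ l → cycleG l u v) (++-assoc ys [ a ] xs) ⟩
  cycleG (ys ++ a ∷ xs) u v         ∎
  where open ≡-Reasoning

rotateTo : ∀ {n} {v : Fin n} (c : List (Fin n)) → v ∈ c →
  Σ (List (Fin n)) λ r → (v ∷ r ↭ c) × (cycleG (v ∷ r) ≈G cycleG c)
rotateTo {v = v} c v∈c with ∈-∃++ v∈c
... | xs , ys , refl = ys ++ xs , ++-comm (v ∷ ys) xs , ≈G-sym (cycleG-rotate xs (v ∷ ys))

pathG-off : ∀ {n} {u : Fin n} (l : List (Fin n)) → u ∉ l → ∀ v → pathG l u v ≡ 0
pathG-off [] u∉l v = refl
pathG-off (a ∷ []) u∉l v = refl
pathG-off (a ∷ b ∷ r) u∉l v =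
  cong₂ _+_ (edgeG-off (u∉l ∘ here) (u∉l ∘ there ∘ here) v) (pathG-off (b ∷ r) (u∉l ∘ there) v)

cycleG-off : ∀ {n} {u : Fin n} (c : List (Fin n)) → u ∉ c → ∀ v → cycleG c u v ≡ 0
cycleG-off [] u∉c v = refl
cycleG-off {u = u} (a ∷ r) u∉c v = trans (cycleG-arcG a r u v) (pathG-off (a ∷ r ++ [ a ]) u∉path v)
  where
  u∉path : u ∉ a ∷ r ++ [ a ]
  u∉path (here u≡a) = u∉c (here u≡a)
  u∉path (there u∈) with ∈-++⁻ r u∈
  ... | inj₁ u∈r = u∉c (there u∈r)
  ... | inj₂ (here u≡a) = u∉c (here u≡a)

cyclesG-off : ∀ {n} {u : Fin n} (cs : List (List (Fin n))) → All (u ∉_) cs → ∀ v → cyclesG cs u v ≡ 0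
cyclesG-off [] [] v = refl
cyclesG-off (c ∷ cs) (u∉c ∷ u∉cs) v = cong₂ _+_ (cycleG-off c u∉c v) (cyclesG-off cs u∉cs v)

pathEdges-snoc : ∀ {A : Set} (h : A) (P : List A) (b : A) →
  pathEdges ((h ∷ P) ++ [ b ]) ≡ pathEdges (h ∷ P) ++ [ (lastOf h P , b) ]
pathEdges-snoc h [] b = refl
pathEdges-snoc h (c ∷ P) b = cong ((h , c) ∷_) (pathEdges-snoc c P b)

pathG-snoc : ∀ {n} (h : Fin n) (P : List (Fin n)) (b : Fin n) →
  pathG ((h ∷ P) ++ [ b ]) ≈G (pathG (h ∷ P) ⊕ edgeG (lastOf h P) b)
pathG-snoc h P b u v =
  trans (cong (λ es → edgesG es u v) (pathEdges-snoc h P b))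
    (trans (edgesG-++ (pathEdges (h ∷ P)) _ u v) (cong (pathG (h ∷ P) u v +_) (+-identityʳ _)))

arcG-∷ : ∀ {n} (a h : Fin n) (P : List (Fin n)) (b : Fin n) →
  arcG a (h ∷ P) b ≈G (edgeG a h ⊕ (pathG (h ∷ P) ⊕ edgeG (lastOf h P) b))
arcG-∷ a h P b u v = cong (edgeG a h u v +_) (pathG-snoc h P b u v)

arcG-atˡ : ∀ {n} {a b h : Fin n} {P : List (Fin n)} → a ∉ h ∷ P → a ≢ b → ∀ w → arcG a (h ∷ P) b a w ≡ δ h w
arcG-atˡ {a = a} {b} {h} {P} a∉ a≢b w = begin
  arcG a (h ∷ P) b a w                                        ≡⟨ arcG-∷ a h P b a w ⟩
  edgeG a h a w + (pathG (h ∷ P) a w + edgeG (lastOf h P) b a w)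
    ≡⟨ cong₂ (λ x y → x + (y + edgeG (lastOf h P) b a w)) (edgeG-atˡ (a∉ ∘ here) w) (pathG-off (h ∷ P) a∉ w) ⟩
  δ h w + edgeG (lastOf h P) b a w                             ≡⟨ cong (δ h w +_) (edgeG-off (a∉ ∘ a≡last) a≢b w) ⟩
  δ h w + 0                                                   ≡⟨ +-identityʳ _ ⟩
  δ h w                                                       ∎
  where
  open ≡-Reasoning
  a≡last : a ≡ lastOf h P → a ∈ h ∷ P
  a≡last a≡l = subst (_∈ h ∷ P) (sym a≡l) (lastOf-∈ h P)

arcG-atʳ : ∀ {n} {a b h : Fin n} {P : List (Fin n)} → b ∉ h ∷ P → a ≢ b → ∀ w →
  arcG a (h ∷ P) b b w ≡ δ (lastOf h P) w
arcG-atʳ {a = a} {b} {h} {P} b∉ a≢b w = begin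
  arcG a (h ∷ P) b b w                                        ≡⟨ arcG-∷ a h P b b w ⟩
  edgeG a h b w + (pathG (h ∷ P) b w + edgeG (lastOf h P) b b w)
    ≡⟨ cong₂ (λ x y → x + (y + edgeG (lastOf h P) b b w)) (edgeG-off (a≢b ∘ sym) (b∉ ∘ here) w) (pathG-off (h ∷ P) b∉ w) ⟩
  edgeG (lastOf h P) b b w                                    ≡⟨ edgeG-atʳ (λ l≡b → b∉ (subst (_∈ h ∷ P) l≡b (lastOf-∈ h P))) w ⟩
  δ (lastOf h P) w                                            ∎
  where open ≡-Reasoning

cycleG-at : ∀ {n} {a h : Fin n} {P : List (Fin n)} → a ∉ h ∷ P → ∀ w →
  cycleG (a ∷ h ∷ P) a w ≡ δ h w + δ (lastOf h P) w
cycleG-at {a = a} {h} {P} a∉ w = begin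
  cycleG (a ∷ h ∷ P) a w                                       ≡⟨ cycleG-arcG a (h ∷ P) a w ⟩
  arcG a (h ∷ P) a a w                                         ≡⟨ arcG-∷ a h P a a w ⟩
  edgeG a h a w + (pathG (h ∷ P) a w + edgeG (lastOf h P) a a w)
    ≡⟨ cong₂ (λ x y → x + (y + edgeG (lastOf h P) a a w)) (edgeG-atˡ (a∉ ∘ here) w) (pathG-off (h ∷ P) a∉ w) ⟩
  δ h w + edgeG (lastOf h P) a a w                              ≡⟨ cong (δ h w +_) (edgeG-atʳ (λ l≡a → a∉ (subst (_∈ h ∷ P) l≡a (lastOf-∈ h P))) w) ⟩
  δ h w + δ (lastOf h P) w                                     ∎
  where open ≡-Reasoning

exchange : ∀ x y z w t → (x + (y + z)) + (w + t) ≡ (w + (y + t)) + (x + z)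
exchange = solve-∀

cycleG-replace : ∀ {n} (a b h : Fin n) (P : List (Fin n)) → let l = lastOf h P in
  (cycleG (b ∷ h ∷ P) ⊕ (edgeG a h ⊕ edgeG a l)) ≈G (cycleG (a ∷ h ∷ P) ⊕ (edgeG b h ⊕ edgeG b l))
cycleG-replace a b h P u v = begin
  cycleG (b ∷ h ∷ P) u v + (edgeG a h u v + edgeG a l u v)
    ≡⟨ cong (_+ (edgeG a h u v + edgeG a l u v)) (trans (cycleG-arcG b (h ∷ P) u v) (arcG-∷ b h P b u v)) ⟩
  (edgeG b h u v + (pathG (h ∷ P) u v + edgeG l b u v)) + (edgeG a h u v + edgeG a l u v)
    ≡⟨ cong (λ x → (edgeG b h u v + (pathG (h ∷ P) u v + x)) + (edgeG a h u v + edgeG a l u v)) (edgeG-comm l b u v) ⟩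
  (edgeG b h u v + (pathG (h ∷ P) u v + edgeG b l u v)) + (edgeG a h u v + edgeG a l u v)
    ≡⟨ exchange (edgeG b h u v) (pathG (h ∷ P) u v) (edgeG b l u v) (edgeG a h u v) (edgeG a l u v) ⟩
  (edgeG a h u v + (pathG (h ∷ P) u v + edgeG a l u v)) + (edgeG b h u v + edgeG b l u v)
    ≡⟨ cong (λ x → (edgeG a h u v + (pathG (h ∷ P) u v + x)) + (edgeG b h u v + edgeG b l u v)) (edgeG-comm a l u v) ⟩
  (edgeG a h u v + (pathG (h ∷ P) u v + edgeG l a u v)) + (edgeG b h u v + edgeG b l u v)
    ≡⟨ cong (_+ (edgeG b h u v + edgeG b l u v)) (trans (cycleG-arcG a (h ∷ P) u v) (arcG-∷ a h P a u v)) ⟨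
  cycleG (a ∷ h ∷ P) u v + (edgeG b h u v + edgeG b l u v) ∎
  where
  open ≡-Reasoning
  l = lastOf h P

reverse-∷ : ∀ {A : Set} (h : A) (P : List A) →
  ∃ λ P' → (reverse (h ∷ P) ≡ lastOf h P ∷ P') × (lastOf (lastOf h P) P' ≡ h)
reverse-∷ h [] = [] , refl , refl
reverse-∷ h (c ∷ P) with reverse-∷ c P
... | P' , rev≡ , last≡ = P' ++ [ h ] , rev-h∷c∷P , lastOf-++ _ P' h []
  where
  rev-h∷c∷P : reverse (h ∷ c ∷ P) ≡ lastOf c P ∷ P' ++ [ h ]
  rev-h∷c∷P = trans (unfold-reverse h (c ∷ P)) (cong (_++ [ h ]) rev≡)

pathG-reverse : ∀ {n} (l : List (Fin n)) → pathG (reverse l) ≈G pathG l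
pathG-reverse [] u v = refl
pathG-reverse (c ∷ []) u v = refl
pathG-reverse (c ∷ e ∷ P) u v with reverse-∷ e P | pathG-reverse (e ∷ P) u v
... | P' , rev≡ , last≡ | ih = begin
  pathG (reverse (c ∷ e ∷ P)) u v                       ≡⟨ cong (λ l → pathG l u v) (trans (unfold-reverse c (e ∷ P)) (cong (_++ [ c ]) rev≡)) ⟩
  pathG ((lastOf e P ∷ P') ++ [ c ]) u v                ≡⟨ pathG-snoc (lastOf e P) P' c u v ⟩
  pathG (lastOf e P ∷ P') u v + edgeG (lastOf (lastOf e P) P') c u v
    ≡⟨ cong₂ (λ l x → pathG l u v + edgeG x c u v) (sym rev≡) last≡ ⟩
  pathG (reverse (e ∷ P)) u v + edgeG e c u v           ≡⟨ cong₂ _+_ ih (edgeG-comm e c u v) ⟩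
  pathG (e ∷ P) u v + edgeG c e u v                     ≡⟨ +-comm (pathG (e ∷ P) u v) _ ⟩
  pathG (c ∷ e ∷ P) u v                                 ∎
  where open ≡-Reasoning

arcG-reverse : ∀ {n} (a h : Fin n) (P : List (Fin n)) (b : Fin n) → let l = lastOf h P in
  (arcG a (reverse (h ∷ P)) b ⊕ (edgeG a h ⊕ edgeG l b)) ≈G (arcG a (h ∷ P) b ⊕ (edgeG a l ⊕ edgeG h b))
arcG-reverse a h P b u v with reverse-∷ h P
... | P' , rev≡ , last≡ = begin
  arcG a (reverse (h ∷ P)) b u v + (edgeG a h u v + edgeG l b u v)
    ≡⟨ cong (λ Q → arcG a Q b u v + (edgeG a h u v + edgeG l b u v)) rev≡ ⟩
  arcG a (l ∷ P') b u v + (edgeG a h u v + edgeG l b u v)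
    ≡⟨ cong (_+ (edgeG a h u v + edgeG l b u v)) (arcG-∷ a l P' b u v) ⟩
  (edgeG a l u v + (pathG (l ∷ P') u v + edgeG (lastOf l P') b u v)) + (edgeG a h u v + edgeG l b u v)
    ≡⟨ cong₂ (λ Q x → (edgeG a l u v + (pathG Q u v + edgeG x b u v)) + (edgeG a h u v + edgeG l b u v)) (sym rev≡) last≡ ⟩
  (edgeG a l u v + (pathG (reverse (h ∷ P)) u v + edgeG h b u v)) + (edgeG a h u v + edgeG l b u v)
    ≡⟨ cong (λ x → (edgeG a l u v + (x + edgeG h b u v)) + (edgeG a h u v + edgeG l b u v)) (pathG-reverse (h ∷ P) u v) ⟩
  (edgeG a l u v + (pathG (h ∷ P) u v + edgeG h b u v)) + (edgeG a h u v + edgeG l b u v)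
    ≡⟨ exchange (edgeG a l u v) (pathG (h ∷ P) u v) (edgeG h b u v) (edgeG a h u v) (edgeG l b u v) ⟩
  (edgeG a h u v + (pathG (h ∷ P) u v + edgeG l b u v)) + (edgeG a l u v + edgeG h b u v)
    ≡⟨ cong (_+ (edgeG a l u v + edgeG h b u v)) (arcG-∷ a h P b u v) ⟨
  arcG a (h ∷ P) b u v + (edgeG a l u v + edgeG h b u v) ∎
  where
  open ≡-Reasoning
  l = lastOf h P

-- Degrees and perfect matchings

interchange : ∀ a b c d → (a + b) + (c + d) ≡ (a + c) + (b + d)
interchange = solve-∀

sumFin-cong : ∀ {n} {f g : Fin n → ℕ} → (∀ v → f v ≡ g v) → sumFin f ≡ sumFin g
sumFin-cong {zero} f≗g = refl
sumFin-cong {suc n} f≗g = cong₂ _+_ (f≗g Fin.zero) (sumFin-cong (f≗g ∘ Fin.suc))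

sumFin-+ : ∀ {n} (f g : Fin n → ℕ) → sumFin (λ v → f v + g v) ≡ sumFin f + sumFin g
sumFin-+ {zero} f g = refl
sumFin-+ {suc n} f g =
  trans (cong ((f Fin.zero + g Fin.zero) +_) (sumFin-+ (f ∘ Fin.suc) (g ∘ Fin.suc)))
    (interchange (f Fin.zero) (g Fin.zero) (sumFin (f ∘ Fin.suc)) (sumFin (g ∘ Fin.suc)))

sumFin-0 : ∀ {n} → sumFin {n} (λ _ → 0) ≡ 0
sumFin-0 {zero} = refl
sumFin-0 {suc n} = sumFin-0 {n}

sumFin-δ : ∀ {n} (a : Fin n) → sumFin (δ a) ≡ 1
sumFin-δ {suc n} Fin.zero = cong suc (sumFin-0 {n})
sumFin-δ {suc n} (Fin.suc a) = trans (sumFin-cong δ-suc) (sumFin-δ a)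
  where
  δ-suc : ∀ v → δ (Fin.suc a) (Fin.suc v) ≡ δ a v
  δ-suc v with a ≟ v
  ... | yes _ = refl
  ... | no _ = refl

deg-⊕ : ∀ {n} (G H : Graph n) u → deg (G ⊕ H) u ≡ deg G u + deg H u
deg-⊕ G H u = sumFin-+ (G u) (H u)

deg-edgeG : ∀ {n} {a b : Fin n} → a ≢ b → ∀ u → deg (edgeG a b) u ≡ δ a u + δ b u
deg-edgeG {n} {a} {b} a≢b u = byCases (a ≟ u) (b ≟ u)
  where
  byCases : Dec (a ≡ u) → Dec (b ≡ u) → deg (edgeG a b) u ≡ δ a u + δ b u
  byCases (yes refl) (yes refl) = contradiction refl a≢b
  byCases (yes refl) (no b≢u) = trans (sumFin-cong (edgeG-atˡ a≢b)) (trans (sumFin-δ b) (cong₂ _+_ (sym (δ-refl a)) (sym (δ-≢ b≢u))))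
  byCases (no a≢u) (yes refl) = trans (sumFin-cong (edgeG-atʳ a≢b)) (trans (sumFin-δ a) (cong₂ _+_ (sym (δ-≢ a≢u)) (sym (δ-refl b))))
  byCases (no a≢u) (no b≢u) = trans (sumFin-cong (edgeG-off (a≢u ∘ sym) (b≢u ∘ sym))) (trans (sumFin-0 {n}) (cong₂ _+_ (sym (δ-≢ a≢u)) (sym (δ-≢ b≢u))))

Loopless : ∀ {n} → List (Fin n × Fin n) → Set
Loopless es = All (λ e → proj₁ e ≢ proj₂ e) es

endCount : ∀ {n} → List (Fin n × Fin n) → Fin n → ℕ
endCount [] u = 0
endCount ((a , b) ∷ es) u = (δ a u + δ b u) + endCount es u

deg-edgesG : ∀ {n} (es : List (Fin n × Fin n)) → Loopless es → ∀ u → deg (edgesG es) u ≡ endCount es u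
deg-edgesG {n} [] [] u = sumFin-0 {n}
deg-edgesG ((a , b) ∷ es) (a≢b ∷ loopless) u =
  trans (deg-⊕ (edgeG a b) (edgesG es) u) (cong₂ _+_ (deg-edgeG a≢b u) (deg-edgesG es loopless u))

occurrences : ∀ {n} → Fin n → List (Fin n) → ℕ
occurrences u [] = 0
occurrences u (a ∷ l) = δ a u + occurrences u l

occurrences-++ : ∀ {n} (u : Fin n) (l₁ l₂ : List (Fin n)) →
  occurrences u (l₁ ++ l₂) ≡ occurrences u l₁ + occurrences u l₂
occurrences-++ u [] l₂ = refl
occurrences-++ u (a ∷ l₁) l₂ = trans (cong (δ a u +_) (occurrences-++ u l₁ l₂)) (sym (+-assoc (δ a u) _ _))

endCount-occurrences : ∀ {n} (es : List (Fin n × Fin n)) u →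
  endCount es u ≡ occurrences u (map proj₁ es) + occurrences u (map proj₂ es)
endCount-occurrences [] u = refl
endCount-occurrences ((a , b) ∷ es) u =
  trans (cong ((δ a u + δ b u) +_) (endCount-occurrences es u))
    (interchange (δ a u) (δ b u) (occurrences u (map proj₁ es)) (occurrences u (map proj₂ es)))

map-proj₁-pathEdges : ∀ {A : Set} (l : List A) (b : A) → map proj₁ (pathEdges (l ++ [ b ])) ≡ l
map-proj₁-pathEdges [] b = refl
map-proj₁-pathEdges (a ∷ []) b = refl
map-proj₁-pathEdges (a ∷ c ∷ l) b = cong (a ∷_) (map-proj₁-pathEdges (c ∷ l) b)

map-proj₂-pathEdges : ∀ {A : Set} (a : A) (l : List A) → map proj₂ (pathEdges (a ∷ l)) ≡ l
map-proj₂-pathEdges a [] = refl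
map-proj₂-pathEdges a (c ∷ l) = cong (c ∷_) (map-proj₂-pathEdges c l)

pathEdges-loopless : ∀ {n} (l : List (Fin n)) → Unique l → Loopless (pathEdges l)
pathEdges-loopless [] _ = []
pathEdges-loopless (a ∷ []) _ = []
pathEdges-loopless (a ∷ c ∷ l) ((a≢c ∷ _) ∷ unique) = a≢c ∷ pathEdges-loopless (c ∷ l) unique

cycEdges-loopless : ∀ {n} (c : List (Fin n)) → IsCycle c → Loopless (cycEdges c)
cycEdges-loopless (h ∷ []) (s≤s () , _)
cycEdges-loopless (h ∷ d ∷ r) (_ , unique@(h∉ ∷ _))
  rewrite cycEdgesFrom-pathEdges h (h ∷ d ∷ r) | pathEdges-snoc h (d ∷ r) h =
  ++⁺ (pathEdges-loopless (h ∷ d ∷ r) unique) (last≢h ∷ [])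
  where
  last≢h : lastOf d r ≢ h
  last≢h l≡h = All¬⇒¬Any h∉ (subst (_∈ d ∷ r) l≡h (lastOf-∈ d r))

deg-cycleG : ∀ {n} (c : List (Fin n)) → IsCycle c → ∀ u → deg (cycleG c) u ≡ 2 * occurrences u c
deg-cycleG (h ∷ r) isCycle u = begin
  deg (cycleG (h ∷ r)) u                          ≡⟨ deg-edgesG (cycEdges (h ∷ r)) (cycEdges-loopless (h ∷ r) isCycle) u ⟩
  endCount (cycEdges (h ∷ r)) u                   ≡⟨ cong (λ es → endCount es u) (cycEdgesFrom-pathEdges h (h ∷ r)) ⟩
  endCount (pathEdges ((h ∷ r) ++ [ h ])) u        ≡⟨ endCount-occurrences (pathEdges ((h ∷ r) ++ [ h ])) u ⟩
  occurrences u (map proj₁ (pathEdges ((h ∷ r) ++ [ h ]))) + occurrences u (map proj₂ (pathEdges (h ∷ r ++ [ h ])))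
    ≡⟨ cong₂ (λ l₁ l₂ → occurrences u l₁ + occurrences u l₂) (map-proj₁-pathEdges (h ∷ r) h) (map-proj₂-pathEdges h (r ++ [ h ])) ⟩
  occurrences u (h ∷ r) + occurrences u (r ++ [ h ])
    ≡⟨ cong (occurrences u (h ∷ r) +_) (trans (occurrences-++ u r [ h ]) (rotate (occurrences u r) (δ h u))) ⟩
  occurrences u (h ∷ r) + (occurrences u (h ∷ r) + 0) ∎
  where
  open ≡-Reasoning
  rotate : ∀ a b → a + (b + 0) ≡ (b + a) + 0
  rotate = solve-∀

CycleOfLength : ∀ {n} → ℕ → List (Fin n) → Set
CycleOfLength k c = IsCycle c × length c ≡ k

cyclesG-even : ∀ {n} (cs : List (List (Fin n))) → All IsCycle cs → ∀ u → 2 ∣ deg (cyclesG cs) u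
cyclesG-even {n} [] [] u = subst (2 ∣_) (sym (sumFin-0 {n})) (divides 0 refl)
cyclesG-even (c ∷ cs) (isCycle ∷ areCycles) u =
  subst (2 ∣_) (sym (deg-⊕ (cycleG c) (cyclesG cs) u))
    (∣m∣n⇒∣m+n (subst (2 ∣_) (sym (deg-cycleG c isCycle u)) (m∣m*n (occurrences u c))) (cyclesG-even cs areCycles u))

endCount-zero : ∀ {n} (es : List (Fin n × Fin n)) v → endCount es v ≡ 0 → ∀ w → edgesG es v w ≡ 0
endCount-zero [] v _ w = refl
endCount-zero ((a , b) ∷ es) v count≡0 w =
  cong₂ _+_ (edgeG-off (a≢v ∘ sym) (b≢v ∘ sym) w) (endCount-zero es v (m+n≡0⇒n≡0 (δ a v + δ b v) count≡0) w)
  where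
  ends≡0 : δ a v + δ b v ≡ 0
  ends≡0 = m+n≡0⇒m≡0 _ count≡0
  a≢v : a ≢ v
  a≢v refl = 0≢1+n (trans (sym (m+n≡0⇒m≡0 (δ a v) ends≡0)) (δ-refl a))
  b≢v : b ≢ v
  b≢v refl = 0≢1+n (trans (sym (m+n≡0⇒n≡0 (δ a v) ends≡0)) (δ-refl b))

partner : ∀ {n} (es : List (Fin n × Fin n)) → Loopless es → (v : Fin n) → endCount es v ≡ 1 →
  Σ (Fin n) λ a → (a ≢ v) × (∀ w → edgesG es v w ≡ δ a w)
partner ((a , b) ∷ es) (a≢b ∷ loopless) v = byCases (a ≟ v) (b ≟ v)
  where
  byCases : Dec (a ≡ v) → Dec (b ≡ v) → (δ a v + δ b v) + endCount es v ≡ 1 →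
    Σ (Fin _) λ c → (c ≢ v) × (∀ w → edgesG ((a , b) ∷ es) v w ≡ δ c w)
  byCases (yes refl) (yes refl) _ = contradiction refl a≢b
  byCases (yes refl) (no b≢a) count≡1 =
    b , b≢a , λ w → trans (cong₂ _+_ (edgeG-atˡ a≢b w) (endCount-zero es a rest≡0 w)) (+-identityʳ _)
    where
    rest≡0 : endCount es a ≡ 0
    rest≡0 = suc-injective (trans (cong₂ (λ x y → (x + y) + endCount es a) (sym (δ-refl a)) (sym (δ-≢ b≢a))) count≡1)
  byCases (no a≢b') (yes refl) count≡1 =
    a , a≢b' , λ w → trans (cong₂ _+_ (edgeG-atʳ a≢b w) (endCount-zero es b rest≡0 w)) (+-identityʳ _)
    where
    rest≡0 : endCount es b ≡ 0
    rest≡0 = suc-injective (trans (cong₂ (λ x y → (x + y) + endCount es b) (sym (δ-≢ a≢b')) (sym (δ-refl b))) count≡1)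
  byCases (no a≢v) (no b≢v) count≡1
    with partner es loopless v (trans (cong₂ (λ x y → (x + y) + endCount es v) (sym (δ-≢ a≢v)) (sym (δ-≢ b≢v))) count≡1)
  ... | c , c≢v , row = c , c≢v , λ w → cong₂ _+_ (edgeG-off (a≢v ∘ sym) (b≢v ∘ sym) w) (row w)

matching-partner : ∀ {n} {es : List (Fin n × Fin n)} → IsPerfectMatching es → (v : Fin n) →
  Σ (Fin n) λ a → (a ≢ v) × (∀ w → edgesG es v w ≡ δ a w)
matching-partner {es = es} (loopless , deg≡1) v = partner es loopless v (trans (sym (deg-edgesG es loopless v)) (deg≡1 v))

data MatchingPart (lam n : ℕ) (es : List (Fin n × Fin n)) : Set where
  none     : 2 ∣ lam * (n ∸ 1) → es ≡ [] → MatchingPart lam n es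
  matching : ¬ (2 ∣ lam * (n ∸ 1)) → IsPerfectMatching es → MatchingPart lam n es

-- Switches and the bounded selection lemma

data Sign : Set where
  pos neg : Sign

opp : Sign → Sign
opp pos = neg
opp neg = pos

End : ℕ → Set
End n = Sign × Fin n

Switch : ℕ → Set
Switch n = End n × End n

turn : ∀ {n} → Switch n → Switch n
turn (s , t) = (t , s)

endDeg : ∀ {n} → Sign → Fin n → End n → ℕ
endDeg pos w (pos , a) = δ a w
endDeg pos w (neg , a) = 0
endDeg neg w (pos , a) = 0
endDeg neg w (neg , a) = δ a w

switchDeg : ∀ {n} → Sign → Fin n → Switch n → ℕ
switchDeg σ w (s , t) = endDeg σ w s + endDeg σ w t

switchesDeg : ∀ {n} → Sign → Fin n → List (Switch n) → ℕ
switchesDeg σ w us = sum (map (switchDeg σ w) us)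

endDeg-opp : ∀ {n} ρ σ (a w : Fin n) → endDeg ρ w (σ , a) + endDeg ρ w (opp σ , a) ≡ δ a w
endDeg-opp pos pos a w = +-identityʳ _
endDeg-opp pos neg a w = refl
endDeg-opp neg pos a w = refl
endDeg-opp neg neg a w = +-identityʳ _

endDeg-oppˡ : ∀ {n} σ (a w : Fin n) → endDeg (opp σ) w (σ , a) ≡ 0
endDeg-oppˡ pos a w = refl
endDeg-oppˡ neg a w = refl

endDeg-positive : ∀ {n} ρ (e : End n) w → 1 ≤ endDeg ρ w e → e ≡ (ρ , w)
endDeg-positive pos (pos , a) w 1≤ with a ≟ w
... | yes refl = refl
endDeg-positive pos (pos , a) w () | no _
endDeg-positive neg (neg , a) w 1≤ with a ≟ w
... | yes refl = refl
endDeg-positive neg (neg , a) w () | no _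

switchDeg-turn : ∀ {n} ρ w (u : Switch n) → switchDeg ρ w (turn u) ≡ switchDeg ρ w u
switchDeg-turn ρ w (s , t) = +-comm (endDeg ρ w t) _

switchesDeg-++ : ∀ {n} σ w (us vs : List (Switch n)) →
  switchesDeg σ w (us ++ vs) ≡ switchesDeg σ w us + switchesDeg σ w vs
switchesDeg-++ σ w us vs = trans (cong sum (map-++ (switchDeg σ w) us vs)) (sum-++ (map (switchDeg σ w) us) _)

switchesDeg-↭ : ∀ {n} σ w {us vs : List (Switch n)} → us ↭ vs → switchesDeg σ w us ≡ switchesDeg σ w vs
switchesDeg-↭ σ w us↭vs = sum-↭ (map⁺ (switchDeg σ w) us↭vs)

Mask : Set
Mask = ℕ → Bool

select : ∀ {A : Set} → Mask → List A → List A
select m [] = []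
select m (u ∷ us) = if m 0 then u ∷ select (m ∘ suc) us else select (m ∘ suc) us

shiftMask : ℕ → Mask → Mask
shiftMask k m i = m (k + i)

select-++ : ∀ {A : Set} (m : Mask) (us vs : List A) →
  select m (us ++ vs) ≡ select m us ++ select (shiftMask (length us) m) vs
select-++ m [] vs = refl
select-++ m (u ∷ us) vs with m 0
... | true = cong (u ∷_) (select-++ (m ∘ suc) us vs)
... | false = select-++ (m ∘ suc) us vs

select-All : ∀ {A : Set} {P : A → Set} (m : Mask) {us : List A} → All P us → All P (select m us)
select-All m [] = []
select-All m (pu ∷ pus) with m 0
... | true = pu ∷ select-All (m ∘ suc) pus
... | false = select-All (m ∘ suc) pus

Disjoint : Mask → Mask → Set
Disjoint m₁ m₂ = ∀ i → m₁ i ∧ m₂ i ≡ false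

_∪_ : Mask → Mask → Mask
(m₁ ∪ m₂) i = m₁ i ∨ m₂ i

sum-select-∪ : ∀ {A : Set} {m₁ m₂ : Mask} → Disjoint m₁ m₂ → (f : A → ℕ) (us : List A) →
  sum (map f (select (m₁ ∪ m₂) us)) ≡ sum (map f (select m₁ us)) + sum (map f (select m₂ us))
sum-select-∪ disj f [] = refl
sum-select-∪ {m₁ = m₁} {m₂} disj f (u ∷ us)
  with m₁ 0 | m₂ 0 | disj 0 | sum-select-∪ {m₁ = m₁ ∘ suc} {m₂ ∘ suc} (disj ∘ suc) f us
... | true | true | () | _
... | true | false | _ | ih = trans (cong (f u +_) ih) (sym (+-assoc (f u) _ _))
... | false | true | _ | ih = trans (cong (f u +_) ih) (x+[y+z]≡y+[x+z] (f u) (sum (map f (select (m₁ ∘ suc) us))) _)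
  where
  x+[y+z]≡y+[x+z] : ∀ x y z → x + (y + z) ≡ y + (x + z)
  x+[y+z]≡y+[x+z] = solve-∀
... | false | false | _ | ih = ih

∪-disjoint : ∀ {m₀ m₁ m : Mask} → Disjoint m₀ m → Disjoint m₁ m → Disjoint (m₀ ∪ m₁) m
∪-disjoint {m₀} {m₁} {m} d₀ d₁ i with m₀ i | m₁ i | m i | d₀ i | d₁ i
... | _ | _ | false | _ | _ = ∧-zeroʳ _
... | false | false | true | _ | _ = refl
... | true | _ | true | () | _
... | false | true | true | _ | ()

Disjoint-sym : ∀ {m₁ m₂ : Mask} → Disjoint m₁ m₂ → Disjoint m₂ m₁
Disjoint-sym {m₁} {m₂} d i = trans (∧-comm (m₂ i) (m₁ i)) (d i)

Group : ℕ → Set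
Group n = Mask × Switch n

Telescopes : ∀ {n} → List (Switch n) → Group n → Set
Telescopes us (m , u) =
  ∀ w → switchesDeg pos w (select m us) + switchDeg neg w u ≡ switchesDeg neg w (select m us) + switchDeg pos w u

Bounded : ∀ {n} → (Fin n → ℕ) → (Fin n → ℕ) → Switch n → Set
Bounded tp tm u = ∀ w → (switchDeg pos w u ≤ tp w) × (switchDeg neg w u ≤ tm w)

Telescopes-turn : ∀ {n} (us : List (Switch n)) m u → Telescopes us (m , u) → Telescopes us (m , turn u)
Telescopes-turn us m u tel w =
  trans (cong (switchesDeg pos w (select m us) +_) (switchDeg-turn neg w u))
    (trans (tel w) (cong (switchesDeg neg w (select m us) +_) (sym (switchDeg-turn pos w u))))

merge-balance : ∀ P₀ P₁ M₀ M₁ x₀ x₁ y₀ y₁ n₀ n₁ p₀ p₁ →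
  P₀ + (x₀ + n₀) ≡ M₀ + (y₀ + p₀) → P₁ + (x₁ + n₁) ≡ M₁ + (y₁ + p₁) → x₀ + x₁ ≡ y₀ + y₁ →
  (P₀ + P₁) + (n₀ + n₁) ≡ (M₀ + M₁) + (p₀ + p₁)
merge-balance P₀ P₁ M₀ M₁ x₀ x₁ y₀ y₁ n₀ n₁ p₀ p₁ e₀ e₁ ex =
  +-cancelʳ-≡ (x₀ + x₁) _ _ (begin
    ((P₀ + P₁) + (n₀ + n₁)) + (x₀ + x₁)   ≡⟨ regroup P₀ P₁ x₀ x₁ n₀ n₁ ⟩
    (P₀ + (x₀ + n₀)) + (P₁ + (x₁ + n₁))   ≡⟨ cong₂ _+_ e₀ e₁ ⟩
    (M₀ + (y₀ + p₀)) + (M₁ + (y₁ + p₁))   ≡⟨ regroup M₀ M₁ y₀ y₁ p₀ p₁ ⟨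
    ((M₀ + M₁) + (p₀ + p₁)) + (y₀ + y₁)   ≡⟨ cong (((M₀ + M₁) + (p₀ + p₁)) +_) ex ⟨
    ((M₀ + M₁) + (p₀ + p₁)) + (x₀ + x₁)   ∎)
  where
  open ≡-Reasoning
  regroup : ∀ a b c d e f → ((a + b) + (e + f)) + (c + d) ≡ (a + (c + e)) + (b + (d + f))
  regroup = solve-∀

Telescopes-merge : ∀ {n} (us : List (Switch n)) {m₀ m₁} σ a t t₁ → Disjoint m₀ m₁ →
  Telescopes us (m₀ , ((σ , a) , t)) → Telescopes us (m₁ , ((opp σ , a) , t₁)) → Telescopes us (m₀ ∪ m₁ , (t , t₁))
Telescopes-merge us {m₀} {m₁} σ a t t₁ disj tel₀ tel₁ w =
  trans (cong (_+ switchDeg neg w (t , t₁)) (sum-select-∪ disj (switchDeg pos w) us))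
    (trans (merge-balance (selDeg pos m₀) (selDeg pos m₁) (selDeg neg m₀) (selDeg neg m₁)
             (endDeg neg w (σ , a)) (endDeg neg w (opp σ , a)) (endDeg pos w (σ , a)) (endDeg pos w (opp σ , a))
             (endDeg neg w t) (endDeg neg w t₁) (endDeg pos w t) (endDeg pos w t₁) (tel₀ w) (tel₁ w)
             (trans (endDeg-opp neg σ a w) (sym (endDeg-opp pos σ a w))))
      (cong (_+ switchDeg pos w (t , t₁)) (sym (sum-select-∪ disj (switchDeg neg w) us))))
  where
  selDeg : Sign → Mask → ℕ
  selDeg ρ m = switchesDeg ρ w (select m us)

first : Mask
first zero = true
first (suc i) = false

later : Mask → Mask
later m zero = false
later m (suc i) = m i

singletons : ∀ {n} → List (Switch n) → List (Group n)
singletons [] = []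
singletons (u ∷ us) = (first , u) ∷ map (λ g → later (proj₁ g) , proj₂ g) (singletons us)

singletons-switches : ∀ {n} (us : List (Switch n)) → map proj₂ (singletons us) ≡ us
singletons-switches [] = refl
singletons-switches (u ∷ us) = cong (u ∷_) (trans (sym (map-∘ (singletons us))) (singletons-switches us))

singletons-length : ∀ {n} (us : List (Switch n)) → length (singletons us) ≡ length us
singletons-length [] = refl
singletons-length (u ∷ us) = cong suc (trans (length-map _ (singletons us)) (singletons-length us))

select-none : ∀ {A : Set} (us : List A) → select (λ _ → false) us ≡ []
select-none [] = refl
select-none (u ∷ us) = select-none us

singletons-telescope : ∀ {n} (us : List (Switch n)) → All (Telescopes us) (singletons us)
singletons-telescope [] = []
singletons-telescope (u ∷ us) = single ∷ map⁺ᴬ (singletons-telescope us)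
  where
  single : Telescopes (u ∷ us) (first , u)
  single w rewrite select-none us = exchange₀ (switchDeg pos w u) (switchDeg neg w u)
    where
    exchange₀ : ∀ a b → (a + 0) + b ≡ (b + 0) + a
    exchange₀ = solve-∀

singletons-disjoint : ∀ {n} (us : List (Switch n)) → AllPairs (λ g h → Disjoint (proj₁ g) (proj₁ h)) (singletons us)
singletons-disjoint [] = []
singletons-disjoint {n} (u ∷ us) =
  map⁺ᴬ (first-disjoint (singletons us)) ∷
  AllPairs.map⁺ {f = λ g → later (proj₁ g) , proj₂ g} (AllPairs.map (λ {g} {h} → later-disjoint {g} {h}) (singletons-disjoint us))
  where
  first-disjoint : ∀ (gs : List (Group n)) → All (λ g → Disjoint first (later (proj₁ g))) gs
  first-disjoint [] = []
  first-disjoint (g ∷ gs) = (λ { zero → refl ; (suc i) → refl }) ∷ first-disjoint gs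
  later-disjoint : ∀ {g h : Group n} → Disjoint (proj₁ g) (proj₁ h) → Disjoint (later (proj₁ g)) (later (proj₁ h))
  later-disjoint d zero = refl
  later-disjoint d (suc i) = d i

extract : ∀ {A : Set} {P : A → Set} {xs : List A} → Any P xs → Σ A λ x → Σ (List A) λ rest → P x × (xs ↭ x ∷ rest)
extract (here px) = _ , _ , px , ↭-refl
extract {xs = x ∷ xs} (there any) with extract any
... | y , rest , py , xs↭ = y , x ∷ rest , py , ↭-trans (↭-prep x xs↭) (↭-swap x y ↭-refl)

positive-switch : ∀ {n} ρ w (gs : List (Group n)) → 1 ≤ switchesDeg ρ w (map proj₂ gs) →
  Any (λ g → 1 ≤ switchDeg ρ w (proj₂ g)) gs
positive-switch ρ w (g ∷ gs) 1≤ with switchDeg ρ w (proj₂ g) in eq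
... | zero = there (positive-switch ρ w gs 1≤)
... | suc _ = here (subst (1 ≤_) (sym eq) (s≤s z≤n))

positive-end : ∀ {n} ρ w (u : Switch n) → 1 ≤ switchDeg ρ w u →
  Σ (End n) λ t → (u ≡ ((ρ , w) , t)) ⊎ (turn u ≡ ((ρ , w) , t))
positive-end ρ w (s , t) 1≤ with endDeg ρ w s in eq
... | suc _ = t , inj₁ (cong (_, t) (endDeg-positive ρ s w (subst (1 ≤_) (sym eq) (s≤s z≤n))))
... | zero = s , inj₂ (cong (_, s) (endDeg-positive ρ t w 1≤))

bound-by-balance : ∀ x X T N T' → X + T ≡ N + T' → x ≤ X → (1 ≤ x → N ≡ 0) → x ≤ T'
bound-by-balance zero X T N T' balance x≤X opposite = z≤n
bound-by-balance (suc x) X T N T' balance x≤X opposite =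
  ≤-trans x≤X (≤-trans (m≤m+n X T) (≤-reflexive (trans balance (cong (_+ T') (opposite (s≤s z≤n))))))

-- Groups of switches, selected by disjoint masks, each telescope to one switch. Merging two groups
-- along opposite ends, or dropping a group whose switch closes up, ends in a group whose switch
-- has no opposite end anywhere; the balance then bounds that switch.
module Selection {n : ℕ} (us : List (Switch n)) (tp tm : Fin n → ℕ) where

  DisjointGroups : Group n → Group n → Set
  DisjointGroups g h = Disjoint (proj₁ g) (proj₁ h)

  groupsDeg : Sign → Fin n → List (Group n) → ℕ
  groupsDeg ρ w gs = switchesDeg ρ w (map proj₂ gs)

  record Invariant (gs : List (Group n)) : Set where
    field
      telescoping : All (Telescopes us) gs
      disjoint    : AllPairs DisjointGroups gs
      balanced    : ∀ w → groupsDeg pos w gs + tm w ≡ groupsDeg neg w gs + tp w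
  open Invariant

  Invariant-↭ : ∀ {gs hs} → gs ↭ hs → Invariant gs → Invariant hs
  Invariant-↭ {gs} {hs} gs↭hs inv = record
    { telescoping = All-resp-↭ gs↭hs (telescoping inv)
    ; disjoint    = PermSetoid.AllPairs-resp-↭ (setoid (Group n)) (λ {g} {h} → Disjoint-sym {proj₁ g} {proj₁ h})
                      (resp₂ DisjointGroups) (↭⇒↭ₛ gs↭hs) (disjoint inv)
    ; balanced    = λ w → trans (cong (_+ tm w) (sym (deg-↭ pos w)))
                             (trans (balanced inv w) (cong (_+ tp w) (deg-↭ neg w)))
    }
    where
    deg-↭ : ∀ ρ w → groupsDeg ρ w gs ≡ groupsDeg ρ w hs
    deg-↭ ρ w = switchesDeg-↭ ρ w (map⁺ proj₂ gs↭hs)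

  Invariant-turn : ∀ {m u gs} → Invariant ((m , u) ∷ gs) → Invariant ((m , turn u) ∷ gs)
  Invariant-turn {m} {u} {gs} inv with telescoping inv | disjoint inv
  ... | tel ∷ tels | dis ∷ diss = record
    { telescoping = Telescopes-turn us m u tel ∷ tels
    ; disjoint    = dis ∷ diss
    ; balanced    = λ w → trans (cong (λ x → (x + groupsDeg pos w gs) + tm w) (switchDeg-turn pos w u))
                             (trans (balanced inv w) (cong (λ x → (x + groupsDeg neg w gs) + tp w) (sym (switchDeg-turn neg w u))))
    }

  Invariant-turn₂ : ∀ {g m u gs} → Invariant (g ∷ (m , u) ∷ gs) → Invariant (g ∷ (m , turn u) ∷ gs)
  Invariant-turn₂ {g} {m} {u} {gs} =
    Invariant-↭ (↭-swap (m , turn u) g ↭-refl) ∘ Invariant-turn ∘ Invariant-↭ (↭-swap g (m , u) ↭-refl)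

  Invariant-dropClosed : ∀ {m σ a gs} → Invariant ((m , ((σ , a) , (opp σ , a))) ∷ gs) → Invariant gs
  Invariant-dropClosed {m} {σ} {a} {gs} inv = record
    { telescoping = All.tail (telescoping inv)
    ; disjoint    = AllPairs.tail (disjoint inv)
    ; balanced    = λ w → +-cancelˡ-≡ (δ a w) _ _
        (trans (sym (+-assoc (δ a w) _ _))
          (trans (cong (λ x → (x + groupsDeg pos w gs) + tm w) (sym (endDeg-opp pos σ a w)))
            (trans (balanced inv w)
              (trans (cong (λ x → (x + groupsDeg neg w gs) + tp w) (endDeg-opp neg σ a w)) (+-assoc (δ a w) _ _)))))
    }

  merge-total : ∀ X₀ X₁ R Y₀ Y₁ S T T' d X' Y' →
    (X₀ + (X₁ + R)) + T ≡ (Y₀ + (Y₁ + S)) + T' → X₀ + X₁ ≡ d + X' → Y₀ + Y₁ ≡ d + Y' →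
    (X' + R) + T ≡ (Y' + S) + T'
  merge-total X₀ X₁ R Y₀ Y₁ S T T' d X' Y' balance eqX eqY = +-cancelˡ-≡ d _ _ (begin
    d + ((X' + R) + T)          ≡⟨ reassoc d X' R T ⟩
    ((d + X') + R) + T          ≡⟨ cong (λ x → (x + R) + T) eqX ⟨
    ((X₀ + X₁) + R) + T         ≡⟨ cong (_+ T) (+-assoc X₀ X₁ R) ⟩
    (X₀ + (X₁ + R)) + T         ≡⟨ balance ⟩
    (Y₀ + (Y₁ + S)) + T'        ≡⟨ cong (_+ T') (+-assoc Y₀ Y₁ S) ⟨
    ((Y₀ + Y₁) + S) + T'        ≡⟨ cong (λ x → (x + S) + T') eqY ⟩
    ((d + Y') + S) + T'         ≡⟨ reassoc d Y' S T' ⟨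
    d + ((Y' + S) + T')         ∎)
    where
    open ≡-Reasoning
    reassoc : ∀ a b c e → a + ((b + c) + e) ≡ ((a + b) + c) + e
    reassoc = solve-∀

  Invariant-merge : ∀ {m₀ m₁ σ a t t₁ gs} →
    Invariant ((m₀ , ((σ , a) , t)) ∷ (m₁ , ((opp σ , a) , t₁)) ∷ gs) → Invariant ((m₀ ∪ m₁ , (t , t₁)) ∷ gs)
  Invariant-merge {m₀} {m₁} {σ} {a} {t} {t₁} {gs} inv with telescoping inv | disjoint inv
  ... | tel₀ ∷ tel₁ ∷ tels | (dis₀₁ ∷ dis₀) ∷ dis₁ ∷ diss = record
    { telescoping = Telescopes-merge us σ a t t₁ dis₀₁ tel₀ tel₁ ∷ tels
    ; disjoint    = All.zipWith (λ { {g} (d₀ , d₁) → ∪-disjoint {m₀} {m₁} {proj₁ g} d₀ d₁ }) (dis₀ , dis₁) ∷ diss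
    ; balanced    = λ w → merge-total (switchDeg pos w ((σ , a) , t)) (switchDeg pos w ((opp σ , a) , t₁)) (groupsDeg pos w gs)
        (switchDeg neg w ((σ , a) , t)) (switchDeg neg w ((opp σ , a) , t₁)) (groupsDeg neg w gs) (tm w) (tp w) (δ a w)
        (switchDeg pos w (t , t₁)) (switchDeg neg w (t , t₁)) (balanced inv w) (ends-cancel pos w) (ends-cancel neg w)
    }
    where
    ends-cancel : ∀ ρ w → switchDeg ρ w ((σ , a) , t) + switchDeg ρ w ((opp σ , a) , t₁) ≡ δ a w + switchDeg ρ w (t , t₁)
    ends-cancel ρ w = trans (interchange (endDeg ρ w (σ , a)) (endDeg ρ w t) _ _) (cong (_+ switchDeg ρ w (t , t₁)) (endDeg-opp ρ σ a w))

  Free : List (Group n) → End n → Set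
  Free gs (σ , a) = groupsDeg (opp σ) a gs ≡ 0

  free-bounded : ∀ {m s t gs} → Invariant ((m , (s , t)) ∷ gs) →
    Free ((m , (s , t)) ∷ gs) s → Free ((m , (s , t)) ∷ gs) t → Bounded tp tm (s , t)
  free-bounded {m} {s} {t} {gs} inv s-free t-free w =
      bound-by-balance _ (total pos) (tm w) (total neg) (tp w) (balanced inv w) (m≤m+n _ _) (no-opposite pos)
    , bound-by-balance _ (total neg) (tp w) (total pos) (tm w) (sym (balanced inv w)) (m≤m+n _ _) (no-opposite neg)
    where
    total : Sign → ℕ
    total ρ = groupsDeg ρ w ((m , (s , t)) ∷ gs)
    no-opposite : ∀ ρ → 1 ≤ switchDeg ρ w (s , t) → total (opp ρ) ≡ 0
    no-opposite ρ 1≤ with positive-end ρ w (s , t) 1≤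
    ... | _ , inj₁ refl = s-free
    ... | _ , inj₂ refl = t-free

  Progress : List (Group n) → Set
  Progress gs = Σ (List (Group n)) λ gs' → (length gs' ≤ length gs) × Invariant gs'

  examine : ∀ m σ a t gs → Invariant ((m , ((σ , a) , t)) ∷ gs) → Free ((m , ((σ , a) , t)) ∷ gs) (σ , a) ⊎ Progress gs
  examine m σ a t gs inv with groupsDeg (opp σ) a ((m , ((σ , a) , t)) ∷ gs) in eq
  ... | zero = inj₁ refl
  ... | suc _ with positive-switch (opp σ) a ((m , ((σ , a) , t)) ∷ gs) (subst (1 ≤_) (sym eq) (s≤s z≤n))
  ...   | here 1≤ with endDeg-positive (opp σ) t a (subst (λ x → 1 ≤ x + endDeg (opp σ) a t) (endDeg-oppˡ σ a a) 1≤)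
  ...     | refl = inj₂ (gs , ≤-refl , Invariant-dropClosed inv)
  examine m σ a t gs inv | suc _ | there 1≤ with extract 1≤
  ... | (m₁ , u₁) , rest , 1≤u₁ , gs↭ with positive-end (opp σ) a u₁ 1≤u₁
  ...   | t₁ , inj₁ refl =
          inj₂ (_ , ≤-reflexive (sym (↭-length gs↭)) , Invariant-merge (Invariant-↭ (↭-prep _ gs↭) inv))
  ...   | t₁ , inj₂ turned =
          inj₂ (_ , ≤-reflexive (sym (↭-length gs↭)) ,
                Invariant-merge (subst (λ u → Invariant (_ ∷ (m₁ , u) ∷ rest)) turned (Invariant-turn₂ (Invariant-↭ (↭-prep _ gs↭) inv))))

  Result : Set
  Result = Σ Mask λ m → Σ (Switch n) λ u → Telescopes us (m , u) × Bounded tp tm u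

  step : ∀ g gs → Invariant (g ∷ gs) → Result ⊎ Progress gs
  step (m , ((σ , a) , (τ , b))) gs inv with examine m σ a (τ , b) gs inv
  ... | inj₂ progress = inj₂ progress
  ... | inj₁ s-free with examine m τ b (σ , a) gs (Invariant-turn inv)
  ...   | inj₂ progress = inj₂ progress
  ...   | inj₁ t-free = inj₁ (m , ((σ , a) , (τ , b)) , All.head (telescoping inv) , free-bounded inv s-free t-free′)
    where
    t-free′ : Free ((m , ((σ , a) , (τ , b))) ∷ gs) (τ , b)
    t-free′ = trans (cong (_+ groupsDeg (opp τ) b gs) (sym (switchDeg-turn (opp τ) b ((σ , a) , (τ , b))))) t-free

  search : (unbalanced : ∃ λ w → tp w ≢ tm w) → ∀ k gs → length gs ≤ k → Invariant gs → Result
  search (w , tp≢tm) k [] _ inv = contradiction (sym (balanced inv w)) tp≢tm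
  search unbalanced (suc k) (g ∷ gs) (s≤s len) inv with step g gs inv
  ... | inj₁ result = result
  ... | inj₂ (gs' , len' , inv') = search unbalanced k gs' (≤-trans len' len) inv'

bounded-selection : ∀ {n} (us : List (Switch n)) (tp tm : Fin n → ℕ) →
  (∀ w → switchesDeg pos w us + tm w ≡ switchesDeg neg w us + tp w) → (∃ λ w → tp w ≢ tm w) →
  Σ Mask λ m → Σ (Switch n) λ u → Telescopes us (m , u) × Bounded tp tm u
bounded-selection us tp tm balanced unbalanced =
  search unbalanced (length us) (singletons us) (≤-reflexive (singletons-length us)) initial
  where
  open Selection us tp tm
  initial : Invariant (singletons us)
  initial = record
    { telescoping = singletons-telescope us
    ; disjoint    = singletons-disjoint us
    ; balanced    = λ w → subst (λ vs → switchesDeg pos w vs + tm w ≡ switchesDeg neg w vs + tp w)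
                              (sym (singletons-switches us)) (balanced w)
    }

-- Switchings at a pair of vertices

pairwise : ∀ a b c d a' b' c' d' → a + c ≡ a' + c' → b + d ≡ b' + d' → (a + b) + (c + d) ≡ (a' + b') + (c' + d')
pairwise a b c d a' b' c' d' e₁ e₂ =
  trans (interchange a b c d) (trans (cong₂ _+_ e₁ e₂) (sym (interchange a' b' c' d')))

module AtPair {n : ℕ} (α β : Fin n) (α≢β : α ≢ β) where

  open PermSetoid (setoid (Fin n)) using (Unique-resp-↭)
  open DecMembership (_≟_ {n}) using (_∈?_)

  vertexOf : Sign → Fin n
  vertexOf pos = α
  vertexOf neg = β

  -- The end (σ , a) stands for the edge between a and vertexOf σ; switching moves it to vertexOf (opp σ).
  removedEdge addedEdge : End n → Graph n
  removedEdge (σ , a) = edgeG (vertexOf σ) a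
  addedEdge (σ , a) = edgeG (vertexOf (opp σ)) a

  switchesG : (End n → Graph n) → List (Switch n) → Graph n
  switchesG f [] = emptyG
  switchesG f ((s , t) ∷ us) = (f s ⊕ f t) ⊕ switchesG f us

  removed added : List (Switch n) → Graph n
  removed = switchesG removedEdge
  added = switchesG addedEdge

  Avoids : Fin n → Set
  Avoids a = (a ≢ α) × (a ≢ β)

  AvoidsPair : Switch n → Set
  AvoidsPair (s , t) = Avoids (proj₂ s) × Avoids (proj₂ t)

  Balanced : List (Switch n) → Graph n → Set
  Balanced us H = ∀ w → Avoids w → switchesDeg pos w us + H β w ≡ switchesDeg neg w us + H α w

  -- switch m is a with α and β swapped on the parts selected by m; only the selected switches' edges move.
  record Switching {A : Set} (G : A → Graph n) (Q : A → Set) (a : A) : Set where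
    field
      switches   : List (Switch n)
      avoiding   : All AvoidsPair switches
      balanced   : Balanced switches (G a)
      switch     : Mask → A
      admissible : ∀ m → Q (switch m)
      switched   : ∀ m → (G (switch m) ⊕ removed (select m switches)) ≈G (G a ⊕ added (select m switches))
  open Switching

  unswitched : ∀ {A : Set} {G : A → Graph n} {Q : A → Set} {a : A} →
    Q a → (∀ w → Avoids w → G a β w ≡ G a α w) → Switching G Q a
  unswitched {a = a} qa rows = record
    { switches = [] ; avoiding = [] ; balanced = rows ; switch = λ _ → a ; admissible = λ _ → qa ; switched = λ _ _ _ → refl }

  single : ∀ {A : Set} {G : A → Graph n} {Q : A → Set} {a : A} (u : Switch n) → AvoidsPair u →
    (∀ w → Avoids w → switchDeg pos w u + G a β w ≡ switchDeg neg w u + G a α w) →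
    (a' : A) → Q a → Q a' → (G a' ⊕ (removedEdge (proj₁ u) ⊕ removedEdge (proj₂ u))) ≈G (G a ⊕ (addedEdge (proj₁ u) ⊕ addedEdge (proj₂ u))) →
    Switching G Q a
  single {G = G} {Q} {a} u avoids balance a' qa qa' eq = record
    { switches   = u ∷ []
    ; avoiding   = avoids ∷ []
    ; balanced   = λ w w-avoids → trans (cong (_+ G a β w) (+-identityʳ _)) (trans (balance w w-avoids) (cong (_+ G a α w) (sym (+-identityʳ _))))
    ; switch     = λ m → if m 0 then a' else a
    ; admissible = λ m → admissibleAt (m 0)
    ; switched   = λ m → switchedAt (m 0)
    }
    where
    admissibleAt : ∀ b → Q (if b then a' else a)
    admissibleAt true = qa'
    admissibleAt false = qa
    switchedAt : ∀ b → (G (if b then a' else a) ⊕ removed (if b then u ∷ [] else [])) ≈G (G a ⊕ added (if b then u ∷ [] else []))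
    switchedAt true x y = trans (cong (G a' x y +_) (+-identityʳ _)) (trans (eq x y) (cong (G a x y +_) (sym (+-identityʳ _))))
    switchedAt false x y = refl

  reindex : ∀ {A B : Set} {G : A → Graph n} {H : B → Graph n} {Q : A → Set} {R : B → Set} {a : A} {b : B}
    (f : A → B) → (∀ x → H (f x) ≈G G x) → (∀ {x} → Q x → R (f x)) → H b ≈G G a → Switching G Q a → Switching H R b
  reindex {G = G} {H} {a = a} {b} f Hf≈G Q⇒R Hb≈Ga S = record
    { switches   = switches S
    ; avoiding   = avoiding S
    ; balanced   = λ w w-avoids → trans (cong (_ +_) (Hb≈Ga β w)) (trans (balanced S w w-avoids) (cong (_ +_) (sym (Hb≈Ga α w))))
    ; switch     = f ∘ switch S
    ; admissible = Q⇒R ∘ admissible S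
    ; switched   = λ m u v → trans (cong (_+ removed (select m (switches S)) u v) (Hf≈G (switch S m) u v))
                               (trans (switched S m u v) (cong (_+ added (select m (switches S)) u v) (sym (Hb≈Ga u v))))
    }

  switchesG-++ : ∀ f (us vs : List (Switch n)) → switchesG f (us ++ vs) ≈G (switchesG f us ⊕ switchesG f vs)
  switchesG-++ f [] vs u v = refl
  switchesG-++ f ((s , t) ∷ us) vs u v = trans (cong (_ +_) (switchesG-++ f us vs u v)) (sym (+-assoc (f s u v + f t u v) _ _))

  select-switchesG : ∀ f m (us vs : List (Switch n)) →
    switchesG f (select m (us ++ vs)) ≈G (switchesG f (select m us) ⊕ switchesG f (select (shiftMask (length us) m) vs))
  select-switchesG f m us vs u v =
    trans (cong (λ ws → switchesG f ws u v) (select-++ m us vs)) (switchesG-++ f (select m us) _ u v)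

  combine : ∀ {A B : Set} {G : A → Graph n} {H : B → Graph n} {Q : A → Set} {R : B → Set} {a : A} {b : B} →
    Switching G Q a → Switching H R b →
    Switching (λ p → G (proj₁ p) ⊕ H (proj₂ p)) (λ p → Q (proj₁ p) × R (proj₂ p)) (a , b)
  combine {G = G} {H} {a = a} {b} S T = record
    { switches   = switches S ++ switches T
    ; avoiding   = ++⁺ (avoiding S) (avoiding T)
    ; balanced   = λ w w-avoids →
        trans (cong (_+ (G a β w + H b β w)) (switchesDeg-++ pos w (switches S) (switches T)))
          (trans (pairwise (switchesDeg pos w (switches S)) (switchesDeg pos w (switches T)) (G a β w) (H b β w)
                           (switchesDeg neg w (switches S)) (switchesDeg neg w (switches T)) (G a α w) (H b α w)
                           (balanced S w w-avoids) (balanced T w w-avoids))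
            (cong (_+ (G a α w + H b α w)) (sym (switchesDeg-++ neg w (switches S) (switches T)))))
    ; switch     = λ m → switch S m , switch T (maskT m)
    ; admissible = λ m → admissible S m , admissible T (maskT m)
    ; switched   = λ m u v →
        trans (cong (G (switch S m) u v + H (switch T (maskT m)) u v +_) (select-switchesG removedEdge m (switches S) (switches T) u v))
          (trans (pairwise (G (switch S m) u v) (H (switch T (maskT m)) u v) (removed (select m (switches S)) u v)
                           (removed (select (maskT m) (switches T)) u v) (G a u v) (H b u v)
                           (added (select m (switches S)) u v) (added (select (maskT m) (switches T)) u v)
                           (switched S m u v) (switched T (maskT m) u v))
            (cong (G a u v + H b u v +_) (sym (select-switchesG addedEdge m (switches S) (switches T) u v))))
    }
    where
    maskT : Mask → Mask
    maskT = shiftMask (length (switches S))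

  avoids-both : ∀ σ {a} → a ≢ vertexOf σ → a ≢ vertexOf (opp σ) → Avoids a
  avoids-both pos a≢α a≢β = a≢α , a≢β
  avoids-both neg a≢β a≢α = a≢α , a≢β

  removedEdge-at : ∀ ρ e → Avoids (proj₂ e) → ∀ v → removedEdge e (vertexOf ρ) v ≡ endDeg ρ v e
  removedEdge-at pos (pos , a) (a≢α , a≢β) v = edgeG-atˡ (a≢α ∘ sym) v
  removedEdge-at pos (neg , a) (a≢α , a≢β) v = edgeG-off α≢β (a≢α ∘ sym) v
  removedEdge-at neg (pos , a) (a≢α , a≢β) v = edgeG-off (α≢β ∘ sym) (a≢β ∘ sym) v
  removedEdge-at neg (neg , a) (a≢α , a≢β) v = edgeG-atˡ (a≢β ∘ sym) v

  addedEdge-at : ∀ ρ e → Avoids (proj₂ e) → ∀ v → addedEdge e (vertexOf ρ) v ≡ endDeg (opp ρ) v e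
  addedEdge-at pos (pos , a) (a≢α , a≢β) v = edgeG-off α≢β (a≢α ∘ sym) v
  addedEdge-at pos (neg , a) (a≢α , a≢β) v = edgeG-atˡ (a≢α ∘ sym) v
  addedEdge-at neg (pos , a) (a≢α , a≢β) v = edgeG-atˡ (a≢β ∘ sym) v
  addedEdge-at neg (neg , a) (a≢α , a≢β) v = edgeG-off (α≢β ∘ sym) (a≢β ∘ sym) v

  switchesG-at : ∀ f r ρ → (∀ e → Avoids (proj₂ e) → ∀ v → f e r v ≡ endDeg ρ v e) →
    ∀ us → All AvoidsPair us → ∀ v → switchesG f us r v ≡ switchesDeg ρ v us
  switchesG-at f r ρ f-at [] [] v = refl
  switchesG-at f r ρ f-at ((s , t) ∷ us) ((s-avoids , t-avoids) ∷ avoiding) v =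
    cong₂ _+_ (cong₂ _+_ (f-at s s-avoids v) (f-at t t-avoids v)) (switchesG-at f r ρ f-at us avoiding v)

  removed-at : ∀ ρ us → All AvoidsPair us → ∀ v → removed us (vertexOf ρ) v ≡ switchesDeg ρ v us
  removed-at ρ = switchesG-at removedEdge (vertexOf ρ) ρ (removedEdge-at ρ)

  added-at : ∀ ρ us → All AvoidsPair us → ∀ v → added us (vertexOf ρ) v ≡ switchesDeg (opp ρ) v us
  added-at ρ = switchesG-at addedEdge (vertexOf ρ) (opp ρ) (addedEdge-at ρ)

  switchesG-off : ∀ f → (∀ e {u v} → Avoids u → Avoids v → f e u v ≡ 0) →
    ∀ us {u v} → Avoids u → Avoids v → switchesG f us u v ≡ 0
  switchesG-off f f-off [] u-avoids v-avoids = refl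
  switchesG-off f f-off ((s , t) ∷ us) u-avoids v-avoids =
    cong₂ _+_ (cong₂ _+_ (f-off s u-avoids v-avoids) (f-off t u-avoids v-avoids)) (switchesG-off f f-off us u-avoids v-avoids)

  removed-off : ∀ us {u v} → Avoids u → Avoids v → removed us u v ≡ 0
  removed-off = switchesG-off removedEdge off
    where
    off : ∀ e {u v} → Avoids u → Avoids v → removedEdge e u v ≡ 0
    off (pos , a) (u≢α , _) (v≢α , _) = edgeG-avoid u≢α v≢α
    off (neg , a) (_ , u≢β) (_ , v≢β) = edgeG-avoid u≢β v≢β

  added-off : ∀ us {u v} → Avoids u → Avoids v → added us u v ≡ 0
  added-off = switchesG-off addedEdge off
    where
    off : ∀ e {u v} → Avoids u → Avoids v → addedEdge e u v ≡ 0
    off (pos , a) (_ , u≢β) (_ , v≢β) = edgeG-avoid u≢β v≢β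
    off (neg , a) (u≢α , _) (v≢α , _) = edgeG-avoid u≢α v≢α

  switchesG-sym : ∀ f → (∀ e → SymmetricG (f e)) → ∀ us → SymmetricG (switchesG f us)
  switchesG-sym f f-sym [] u v = refl
  switchesG-sym f f-sym ((s , t) ∷ us) u v = cong₂ _+_ (cong₂ _+_ (f-sym s u v) (f-sym t u v)) (switchesG-sym f f-sym us u v)

  removed-sym : ∀ us → SymmetricG (removed us)
  removed-sym = switchesG-sym removedEdge (λ e → edgeG-sym (vertexOf (proj₁ e)) (proj₂ e))

  added-sym : ∀ us → SymmetricG (added us)
  added-sym = switchesG-sym addedEdge (λ e → edgeG-sym (vertexOf (opp (proj₁ e))) (proj₂ e))

  ≈G-fromRows : ∀ {F H : Graph n} → SymmetricG F → SymmetricG H →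
    (∀ v → F α v ≡ H α v) → (∀ v → F β v ≡ H β v) → (∀ {u v} → Avoids u → Avoids v → F u v ≡ H u v) → F ≈G H
  ≈G-fromRows {F} {H} F-sym H-sym rowα rowβ off u v with u ≟ α | u ≟ β | v ≟ α | v ≟ β
  ... | yes refl | _ | _ | _ = rowα v
  ... | no _ | yes refl | _ | _ = rowβ v
  ... | no _ | no _ | yes refl | _ = trans (F-sym u α) (trans (rowα u) (H-sym α u))
  ... | no _ | no _ | no _ | yes refl = trans (F-sym u β) (trans (rowβ u) (H-sym β u))
  ... | no u≢α | no u≢β | no v≢α | no v≢β = off (u≢α , u≢β) (v≢α , v≢β)

  net-effect : ∀ S u → All AvoidsPair S → AvoidsPair u →
    (∀ w → switchesDeg pos w S + switchDeg neg w u ≡ switchesDeg neg w S + switchDeg pos w u) →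
    (added S ⊕ removed (u ∷ [])) ≈G (removed S ⊕ added (u ∷ []))
  net-effect S u S-avoids u-avoids same =
    ≈G-fromRows (⊕-sym (added-sym S) (removed-sym (u ∷ []))) (⊕-sym (removed-sym S) (added-sym (u ∷ [])))
      (λ v → trans (cong₂ _+_ (added-at pos S S-avoids v) (removed-at pos (u ∷ []) (u-avoids ∷ []) v))
               (trans (cong (switchesDeg neg v S +_) (+-identityʳ _))
                 (trans (sym (same v))
                   (sym (cong₂ _+_ (removed-at pos S S-avoids v) (trans (added-at pos (u ∷ []) (u-avoids ∷ []) v) (+-identityʳ _)))))))
      (λ v → trans (cong₂ _+_ (added-at neg S S-avoids v) (removed-at neg (u ∷ []) (u-avoids ∷ []) v))
               (trans (cong (switchesDeg pos v S +_) (+-identityʳ _))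
                 (trans (same v)
                   (sym (cong₂ _+_ (removed-at neg S S-avoids v) (trans (added-at neg (u ∷ []) (u-avoids ∷ []) v) (+-identityʳ _)))))))
      (λ u-av v-av → trans (cong₂ _+_ (added-off S u-av v-av) (removed-off (u ∷ []) u-av v-av))
                       (sym (cong₂ _+_ (removed-off S u-av v-av) (added-off (u ∷ []) u-av v-av))))

  avoids-vertex : ∀ {w} → Avoids w → ∀ σ → w ≢ vertexOf σ
  avoids-vertex (w≢α , _) pos = w≢α
  avoids-vertex (_ , w≢β) neg = w≢β

  avoiding-of : ∀ {P} → α ∉ P → β ∉ P → All Avoids P
  avoiding-of {P} α∉ β∉ = All.zipWith (λ { (α≢x , β≢x) → α≢x ∘ sym , β≢x ∘ sym }) (¬Any⇒All¬ P α∉ , ¬Any⇒All¬ P β∉)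

  loop-balance : ∀ σ {h P} → vertexOf σ ∉ h ∷ P → vertexOf (opp σ) ∉ vertexOf σ ∷ h ∷ P → ∀ w →
    let u = ((σ , h) , (σ , lastOf h P)) ; c = vertexOf σ ∷ h ∷ P in
    switchDeg pos w u + cycleG c β w ≡ switchDeg neg w u + cycleG c α w
  loop-balance pos {h} {P} a∉ b∉ w =
    trans (cong (δ h w + δ (lastOf h P) w +_) (cycleG-off (α ∷ h ∷ P) b∉ w)) (trans (+-identityʳ _) (sym (cycleG-at a∉ w)))
  loop-balance neg {h} {P} a∉ b∉ w =
    trans (cycleG-at a∉ w) (sym (trans (cong (δ h w + δ (lastOf h P) w +_) (cycleG-off (β ∷ h ∷ P) b∉ w)) (+-identityʳ _)))

  loopSwitching : ∀ σ h P → Unique (vertexOf σ ∷ h ∷ P) → vertexOf (opp σ) ∉ h ∷ P →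
    Switching cycleG (CycleOfLength (length (vertexOf σ ∷ h ∷ P))) (vertexOf σ ∷ h ∷ P)
  loopSwitching σ h P unique@(a≢ ∷ unique′) b∉ =
    single ((σ , h) , (σ , lastOf h P)) (avoids (here refl) , avoids (lastOf-∈ h P)) (λ w _ → loop-balance σ a∉ b∉′ w)
      (vertexOf (opp σ) ∷ h ∷ P) ((two≤ , unique) , refl) ((two≤ , ¬Any⇒All¬ (h ∷ P) b∉ ∷ unique′) , refl)
      (cycleG-replace (vertexOf σ) (vertexOf (opp σ)) h P)
    where
    two≤ : 2 ≤ length (vertexOf σ ∷ h ∷ P)
    two≤ = s≤s (s≤s z≤n)
    a∉ : vertexOf σ ∉ h ∷ P
    a∉ = All¬⇒¬Any a≢
    b∉′ : vertexOf (opp σ) ∉ vertexOf σ ∷ h ∷ P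
    b∉′ (here b≡a) = α≢β (opp-distinct σ b≡a)
      where
      opp-distinct : ∀ σ → vertexOf (opp σ) ≡ vertexOf σ → α ≡ β
      opp-distinct pos β≡α = sym β≡α
      opp-distinct neg α≡β = α≡β
    b∉′ (there b∈) = b∉ b∈
    avoids : ∀ {x} → x ∈ h ∷ P → Avoids x
    avoids x∈ = avoids-both σ (λ x≡a → a∉ (subst (_∈ h ∷ P) x≡a x∈)) (λ x≡b → b∉ (subst (_∈ h ∷ P) x≡b x∈))

  arc-balance : ∀ σ {h P} → All Avoids (h ∷ P) → ∀ w →
    let u = ((σ , h) , (opp σ , lastOf h P)) ; G = arcG (vertexOf σ) (h ∷ P) (vertexOf (opp σ)) in
    switchDeg pos w u + G β w ≡ switchDeg neg w u + G α w
  arc-balance pos {h} {P} avoiding w = begin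
    (δ h w + 0) + arcG α (h ∷ P) β β w   ≡⟨ cong₂ _+_ (+-identityʳ _) (arcG-atʳ β∉ α≢β w) ⟩
    δ h w + δ (lastOf h P) w             ≡⟨ +-comm (δ h w) _ ⟩
    δ (lastOf h P) w + δ h w             ≡⟨ cong (δ (lastOf h P) w +_) (arcG-atˡ α∉ α≢β w) ⟨
    δ (lastOf h P) w + arcG α (h ∷ P) β α w ∎
    where
    open ≡-Reasoning
    α∉ = All¬⇒¬Any (All.map (λ av → proj₁ av ∘ sym) avoiding)
    β∉ = All¬⇒¬Any (All.map (λ av → proj₂ av ∘ sym) avoiding)
  arc-balance neg {h} {P} avoiding w = begin
    δ (lastOf h P) w + arcG β (h ∷ P) α β w  ≡⟨ cong (δ (lastOf h P) w +_) (arcG-atˡ β∉ (α≢β ∘ sym) w) ⟩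
    δ (lastOf h P) w + δ h w                 ≡⟨ +-comm _ (δ h w) ⟩
    δ h w + δ (lastOf h P) w                 ≡⟨ cong₂ _+_ (+-identityʳ _) (arcG-atʳ α∉ (α≢β ∘ sym) w) ⟨
    (δ h w + 0) + arcG β (h ∷ P) α α w      ∎
    where
    open ≡-Reasoning
    α∉ = All¬⇒¬Any (All.map (λ av → proj₁ av ∘ sym) avoiding)
    β∉ = All¬⇒¬Any (All.map (λ av → proj₂ av ∘ sym) avoiding)

  arcG-reverse-switched : ∀ (a b h : Fin n) P → let l = lastOf h P in
    (arcG a (reverse (h ∷ P)) b ⊕ (edgeG a h ⊕ edgeG b l)) ≈G (arcG a (h ∷ P) b ⊕ (edgeG b h ⊕ edgeG a l))
  arcG-reverse-switched a b h P u v =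
    trans (cong (λ x → arcG a (reverse (h ∷ P)) b u v + (edgeG a h u v + x)) (edgeG-comm b l u v))
      (trans (arcG-reverse a h P b u v)
        (cong (arcG a (h ∷ P) b u v +_) (trans (+-comm (edgeG a l u v) _) (cong (_+ edgeG a l u v) (edgeG-comm h b u v)))))
    where
    l = lastOf h P

  -- Swapping α and β on a path from one to the other is the same as reversing the path.
  arcSwitching : ∀ σ P → All Avoids P →
    Switching (λ Q → arcG (vertexOf σ) Q (vertexOf (opp σ))) (_↭ P) P
  arcSwitching σ [] _ = unswitched ↭-refl (λ w w-avoids → trans (ends-off β w-avoids) (sym (ends-off α w-avoids)))
    where
    ends-off : ∀ r {w} → Avoids w → arcG (vertexOf σ) [] (vertexOf (opp σ)) r w ≡ 0
    ends-off r w-avoids = cong (_+ 0) (trans (edgeG-sym (vertexOf σ) _ r _)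
      (edgeG-off (avoids-vertex w-avoids σ) (avoids-vertex w-avoids (opp σ)) r))
  arcSwitching σ (h ∷ P) avoiding =
    single ((σ , h) , (opp σ , lastOf h P)) (All.head avoiding , All.lookup avoiding (lastOf-∈ h P)) (λ w _ → arc-balance σ avoiding w)
      (reverse (h ∷ P)) ↭-refl (↭-reverse (h ∷ P)) (switched′ σ)
    where
    switched′ : ∀ σ → (arcG (vertexOf σ) (reverse (h ∷ P)) (vertexOf (opp σ)) ⊕ (removedEdge (σ , h) ⊕ removedEdge (opp σ , lastOf h P)))
                  ≈G (arcG (vertexOf σ) (h ∷ P) (vertexOf (opp σ)) ⊕ (addedEdge (σ , h) ⊕ addedEdge (opp σ , lastOf h P)))
    switched′ pos = arcG-reverse-switched α β h P
    switched′ neg = arcG-reverse-switched β α h P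

  two≤length : ∀ a (xs : List (Fin n)) b ys → 2 ≤ length (a ∷ xs ++ b ∷ ys)
  two≤length a [] b ys = s≤s (s≤s z≤n)
  two≤length a (x ∷ xs) b ys = s≤s (s≤s z≤n)

  mixedSwitching : ∀ P₁ P₂ → Unique (α ∷ P₁ ++ β ∷ P₂) →
    Switching cycleG (CycleOfLength (length (α ∷ P₁ ++ β ∷ P₂))) (α ∷ P₁ ++ β ∷ P₂)
  mixedSwitching P₁ P₂ unique@(α≢ ∷ unique′) =
    reindex (λ p → α ∷ proj₁ p ++ β ∷ proj₂ p) (λ p → cycleG-split α (proj₁ p) β (proj₂ p)) toCycle
      (cycleG-split α P₁ β P₂) (combine (arcSwitching pos P₁ (avoiding-of α∉₁ β∉₁)) (arcSwitching neg P₂ (avoiding-of α∉₂ β∉₂)))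
    where
    α∉ : α ∉ P₁ ++ β ∷ P₂
    α∉ = All¬⇒¬Any α≢
    β∉ : β ∉ P₁ ++ P₂
    β∉ with Unique-resp-↭ (↭⇒↭ₛ (shift β P₁ P₂)) unique′
    ... | β≢ ∷ _ = All¬⇒¬Any β≢
    α∉₁ : α ∉ P₁
    α∉₁ = α∉ ∘ ∈-++⁺ˡ
    α∉₂ : α ∉ P₂
    α∉₂ = α∉ ∘ ∈-++⁺ʳ P₁ ∘ there
    β∉₁ : β ∉ P₁
    β∉₁ = β∉ ∘ ∈-++⁺ˡ
    β∉₂ : β ∉ P₂
    β∉₂ = β∉ ∘ ∈-++⁺ʳ P₁
    toCycle : ∀ {p} → (proj₁ p ↭ P₁) × (proj₂ p ↭ P₂) →
      CycleOfLength (length (α ∷ P₁ ++ β ∷ P₂)) (α ∷ proj₁ p ++ β ∷ proj₂ p)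
    toCycle {P₁′ , P₂′} (P₁′↭ , P₂′↭) =
      (two≤length α P₁′ β P₂′ , Unique-resp-↭ (↭⇒↭ₛ (↭-sym perm)) unique) , ↭-length perm
      where
      perm : α ∷ P₁′ ++ β ∷ P₂′ ↭ α ∷ P₁ ++ β ∷ P₂
      perm = ↭-prep α (++⁺↭ P₁′↭ (↭-prep β P₂′↭))

  resize : ∀ {c c′ x : List (Fin n)} → c′ ↭ c → CycleOfLength (length c′) x → CycleOfLength (length c) x
  resize c′↭c (isCycle , length≡) = isCycle , trans length≡ (↭-length c′↭c)

  rotatedAtα : ∀ r → Unique (α ∷ r) → 2 ≤ length (α ∷ r) → Switching cycleG (CycleOfLength (length (α ∷ r))) (α ∷ r)
  rotatedAtα r unique two≤ with β ∈? r
  ... | yes β∈r with ∈-∃++ β∈r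
  ...   | P₁ , P₂ , refl = mixedSwitching P₁ P₂ unique
  rotatedAtα [] unique (s≤s ()) | no _
  rotatedAtα (h ∷ P) unique two≤ | no β∉r = loopSwitching pos h P unique β∉r

  rotatedAtβ : ∀ r → Unique (β ∷ r) → 2 ≤ length (β ∷ r) → α ∉ r → Switching cycleG (CycleOfLength (length (β ∷ r))) (β ∷ r)
  rotatedAtβ [] unique (s≤s ()) α∉r
  rotatedAtβ (h ∷ P) unique two≤ α∉r = loopSwitching neg h P unique α∉r

  viaRotation : ∀ {a} (c : List (Fin n)) → IsCycle c → a ∈ c →
    (∀ r → Unique (a ∷ r) → 2 ≤ length (a ∷ r) → a ∷ r ↭ c → Switching cycleG (CycleOfLength (length (a ∷ r))) (a ∷ r)) →
    Switching cycleG (CycleOfLength (length c)) c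
  viaRotation c (two≤ , unique) a∈c switching =
    let (r , r↭c , r≈c) = rotateTo c a∈c in
    reindex id (λ _ _ _ → refl) (resize r↭c) (≈G-sym r≈c)
      (switching r (Unique-resp-↭ (↭⇒↭ₛ (↭-sym r↭c)) unique) (subst (2 ≤_) (sym (↭-length r↭c)) two≤) r↭c)

  cycleSwitching : (c : List (Fin n)) → IsCycle c → Switching cycleG (CycleOfLength (length c)) c
  cycleSwitching c isCycle with α ∈? c | β ∈? c
  ... | yes α∈c | _ = viaRotation c isCycle α∈c λ r unique two≤ _ → rotatedAtα r unique two≤
  ... | no α∉c | yes β∈c = viaRotation c isCycle β∈c λ r unique two≤ r↭c → rotatedAtβ r unique two≤ (α∉c ∘ ∈-resp-↭ r↭c ∘ there)
  ... | no α∉c | no β∉c = unswitched (isCycle , refl) (λ w _ → trans (cycleG-off c β∉c w) (sym (cycleG-off c α∉c w)))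

  cyclesSwitching : (cs : List (List (Fin n))) → All IsCycle cs → Switching cyclesG (CycleList (map length cs)) cs
  cyclesSwitching [] [] = unswitched ([] , refl) (λ w _ → refl)
  cyclesSwitching (c ∷ cs) (isCycle ∷ areCycles) =
    reindex (λ p → proj₁ p ∷ proj₂ p) (λ _ _ _ → refl)
      (λ { ((isCycle′ , length≡) , (areCycles′ , lengths≡)) → isCycle′ ∷ areCycles′ , cong₂ _∷_ length≡ lengths≡ })
      (λ _ _ → refl) (combine (cycleSwitching c isCycle) (cyclesSwitching cs areCycles))

  transpose : Fin n → Fin n
  transpose v with v ≟ α | v ≟ β
  ... | yes _ | _ = β
  ... | no _ | yes _ = α
  ... | no _ | no _ = v

  transpose-α : transpose α ≡ β
  transpose-α with α ≟ α
  ... | yes _ = refl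
  ... | no α≢α = contradiction refl α≢α

  transpose-β : transpose β ≡ α
  transpose-β with β ≟ α | β ≟ β
  ... | yes β≡α | _ = contradiction (sym β≡α) α≢β
  ... | no _ | yes _ = refl
  ... | no _ | no β≢β = contradiction refl β≢β

  transpose-avoid : ∀ {v} → Avoids v → transpose v ≡ v
  transpose-avoid {v} (v≢α , v≢β) with v ≟ α | v ≟ β
  ... | yes v≡α | _ = contradiction v≡α v≢α
  ... | no _ | yes v≡β = contradiction v≡β v≢β
  ... | no _ | no _ = refl

  transpose-involutive : ∀ v → transpose (transpose v) ≡ v
  transpose-involutive v with v ≟ α | v ≟ β
  ... | yes refl | _ = transpose-β
  ... | no _ | yes refl = transpose-α
  ... | no v≢α | no v≢β = transpose-avoid (v≢α , v≢β)

  ⌊transpose≟⌋ : ∀ a u → ⌊ transpose a ≟ u ⌋ ≡ ⌊ a ≟ transpose u ⌋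
  ⌊transpose≟⌋ a u with transpose a ≟ u | a ≟ transpose u
  ... | yes _ | yes _ = refl
  ... | no _ | no _ = refl
  ... | yes ta≡u | no a≢tu = contradiction (trans (sym (transpose-involutive a)) (cong transpose ta≡u)) a≢tu
  ... | no ta≢u | yes a≡tu = contradiction (trans (cong transpose a≡tu) (transpose-involutive u)) ta≢u

  δ-transpose : ∀ a u → δ (transpose a) u ≡ δ a (transpose u)
  δ-transpose a u = cong (if_then 1 else 0) (⌊transpose≟⌋ a u)

  δ-avoid-transpose : ∀ {a} → Avoids a → ∀ v → δ a (transpose v) ≡ δ a v
  δ-avoid-transpose a-avoids v = trans (sym (δ-transpose _ v)) (cong (λ x → δ x v) (transpose-avoid a-avoids))

  transposeEdge : Fin n × Fin n → Fin n × Fin n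
  transposeEdge (a , b) = transpose a , transpose b

  edgesG-transpose : ∀ es u v → edgesG (map transposeEdge es) u v ≡ edgesG es (transpose u) (transpose v)
  edgesG-transpose [] u v = refl
  edgesG-transpose ((a , b) ∷ es) u v = cong₂ _+_ edge (edgesG-transpose es u v)
    where
    edge : edgeG (transpose a) (transpose b) u v ≡ edgeG a b (transpose u) (transpose v)
    edge rewrite ⌊transpose≟⌋ a u | ⌊transpose≟⌋ b v | ⌊transpose≟⌋ a v | ⌊transpose≟⌋ b u = refl

  endCount-transpose : ∀ es u → endCount (map transposeEdge es) u ≡ endCount es (transpose u)
  endCount-transpose [] u = refl
  endCount-transpose ((a , b) ∷ es) u = cong₂ _+_ (cong₂ _+_ (δ-transpose a u) (δ-transpose b u)) (endCount-transpose es u)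

  transpose-loopless : ∀ es → Loopless es → Loopless (map transposeEdge es)
  transpose-loopless [] [] = []
  transpose-loopless ((a , b) ∷ es) (a≢b ∷ loopless) =
    (λ ta≡tb → a≢b (trans (sym (transpose-involutive a)) (trans (cong transpose ta≡tb) (transpose-involutive b))))
      ∷ transpose-loopless es loopless

  transpose-matching : ∀ {es} → IsPerfectMatching es → IsPerfectMatching (map transposeEdge es)
  transpose-matching {es} (loopless , deg≡1) =
    transpose-loopless es loopless , λ u →
      trans (deg-edgesG (map transposeEdge es) (transpose-loopless es loopless) u)
        (trans (endCount-transpose es u) (trans (sym (deg-edgesG es loopless (transpose u))) (deg≡1 (transpose u))))

  transpose-switched : ∀ es {a b} → Avoids a → Avoids b → (∀ w → edgesG es α w ≡ δ a w) → (∀ w → edgesG es β w ≡ δ b w) →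
    (edgesG (map transposeEdge es) ⊕ (edgeG α a ⊕ edgeG β b)) ≈G (edgesG es ⊕ (edgeG β a ⊕ edgeG α b))
  transpose-switched es {a} {b} a-avoids@(a≢α , a≢β) b-avoids@(b≢α , b≢β) rowα rowβ =
    ≈G-fromRows
      (λ u v → cong₂ _+_ (trans (edgesG-transpose es u v) (trans (edgesG-sym es _ _) (sym (edgesG-transpose es v u))))
                         (cong₂ _+_ (edgeG-sym α a u v) (edgeG-sym β b u v)))
      (⊕-sym (edgesG-sym es) (⊕-sym (edgeG-sym β a) (edgeG-sym α b)))
      (λ v → begin
        edgesG (map transposeEdge es) α v + (edgeG α a α v + edgeG β b α v)
          ≡⟨ cong₂ _+_ (trans (edgesG-transpose es α v) (cong (λ x → edgesG es x (transpose v)) transpose-α))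
                       (cong₂ _+_ (edgeG-atˡ (a≢α ∘ sym) v) (edgeG-off α≢β (b≢α ∘ sym) v)) ⟩
        edgesG es β (transpose v) + (δ a v + 0)    ≡⟨ cong (_+ (δ a v + 0)) (trans (rowβ _) (δ-avoid-transpose b-avoids v)) ⟩
        δ b v + (δ a v + 0)                         ≡⟨ swap-sum (δ b v) (δ a v) ⟩
        δ a v + (0 + δ b v)                         ≡⟨ cong₂ _+_ (rowα v) (cong₂ _+_ (edgeG-off α≢β (a≢α ∘ sym) v) (edgeG-atˡ (b≢α ∘ sym) v)) ⟨
        edgesG es α v + (edgeG β a α v + edgeG α b α v) ∎)
      (λ v → begin
        edgesG (map transposeEdge es) β v + (edgeG α a β v + edgeG β b β v)
          ≡⟨ cong₂ _+_ (trans (edgesG-transpose es β v) (cong (λ x → edgesG es x (transpose v)) transpose-β))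
                       (cong₂ _+_ (edgeG-off (α≢β ∘ sym) (a≢β ∘ sym) v) (edgeG-atˡ (b≢β ∘ sym) v)) ⟩
        edgesG es α (transpose v) + (0 + δ b v)    ≡⟨ cong (_+ δ b v) (trans (rowα _) (δ-avoid-transpose a-avoids v)) ⟩
        δ a v + δ b v                               ≡⟨ swap-sum′ (δ a v) (δ b v) ⟩
        δ b v + (δ a v + 0)                         ≡⟨ cong₂ _+_ (rowβ v) (cong₂ _+_ (edgeG-atˡ (a≢β ∘ sym) v) (edgeG-off (α≢β ∘ sym) (b≢β ∘ sym) v)) ⟨
        edgesG es β v + (edgeG β a β v + edgeG α b β v) ∎)
      (λ {u} {v} u-avoids@(u≢α , u≢β) v-avoids@(v≢α , v≢β) →
        cong₂ _+_ (trans (edgesG-transpose es u v) (cong₂ (edgesG es) (transpose-avoid u-avoids) (transpose-avoid v-avoids)))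
          (trans (cong₂ _+_ (edgeG-avoid u≢α v≢α) (edgeG-avoid u≢β v≢β)) (sym (cong₂ _+_ (edgeG-avoid u≢β v≢β) (edgeG-avoid u≢α v≢α)))))
    where
    open ≡-Reasoning
    swap-sum : ∀ x y → x + (y + 0) ≡ y + (0 + x)
    swap-sum = solve-∀
    swap-sum′ : ∀ x y → x + y ≡ y + (x + 0)
    swap-sum′ = solve-∀

  matchingSwitching : ∀ {lam} es → MatchingPart lam n es → Switching edgesG (MatchingPart lam n) es
  matchingSwitching es (none even refl) = unswitched (none even refl) (λ w _ → refl)
  matchingSwitching es (matching odd pm) with matching-partner pm α | matching-partner pm β
  ... | a , a≢α , rowα | b , b≢β , rowβ with a ≟ β
  ...   | yes refl = unswitched (matching odd pm) λ w (w≢α , w≢β) →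
            trans (rowβ w) (trans (cong (λ x → δ x w) b≡α) (trans (δ-≢ (w≢α ∘ sym)) (sym (trans (rowα w) (δ-≢ (w≢β ∘ sym))))))
    where
    b≡α : b ≡ α
    b≡α = δ≡1⇒≡ (trans (sym (rowβ α)) (trans (edgesG-sym es β α) (trans (rowα β) (δ-refl β))))
  ...   | no a≢β = single ((pos , a) , (neg , b)) ((a≢α , a≢β) , (b≢α , b≢β))
            (λ w _ → trans (cong ((δ a w + 0) +_) (rowβ w)) (trans (cong (_+ δ b w) (+-identityʳ _)) (trans (+-comm (δ a w) _) (cong (δ b w +_) (sym (rowα w))))))
            (map transposeEdge es) (matching odd pm) (matching odd (transpose-matching pm))
            (transpose-switched es (a≢α , a≢β) (b≢α , b≢β) rowα rowβ)
    where
    b≢α : b ≢ α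
    b≢α b≡α = a≢β (δ≡1⇒≡ (trans (sym (rowα β)) (trans (edgesG-sym es α β) (trans (rowβ α) (trans (cong (λ x → δ x α) b≡α) (δ-refl α))))))

-- Switching the leave

module LeaveSwitch {n : ℕ} (α β x p q : Fin n) (distinct : Unique (α ∷ β ∷ x ∷ p ∷ q ∷ [])) where

  α≢ : All (α ≢_) (β ∷ x ∷ p ∷ q ∷ [])
  α≢ = AllPairs.head distinct

  β≢ : All (β ≢_) (x ∷ p ∷ q ∷ [])
  β≢ = AllPairs.head (AllPairs.tail distinct)

  x≢ : All (x ≢_) (p ∷ q ∷ [])
  x≢ = AllPairs.head (AllPairs.tail (AllPairs.tail distinct))

  α≢β : α ≢ β
  α≢β = All.head α≢

  open AtPair α β α≢β

  avoids : ∀ {a} → a ∈ x ∷ p ∷ q ∷ [] → Avoids a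
  avoids a∈ = All.lookup (All.tail α≢) a∈ ∘ sym , All.lookup β≢ a∈ ∘ sym

  x-avoids : Avoids x
  x-avoids = avoids (here refl)

  p-avoids : Avoids p
  p-avoids = avoids (there (here refl))

  q-avoids : Avoids q
  q-avoids = avoids (there (there (here refl)))

  x≢p : x ≢ p
  x≢p = All.head x≢

  x≢q : x ≢ q
  x≢q = All.lookup x≢ (there (here refl))

  p≢q : p ≢ q
  p≢q = All.head (AllPairs.head (AllPairs.tail (AllPairs.tail (AllPairs.tail distinct))))

  -- In the leave, α is joined to x twice and β to p and q.
  tp tm : Fin n → ℕ
  tp w = δ p w + δ q w
  tm w = δ x w + δ x w

  oldPart : Graph n
  oldPart = ((edgeG p β ⊕ edgeG β q) ⊕ edgeG x α) ⊕ edgeG α x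

  newPart : Fin n → Fin n → Graph n
  newPart γ ε = ((edgeG p ε ⊕ edgeG ε x) ⊕ edgeG x γ) ⊕ edgeG γ q

  LeaveShape : Switch n → Set
  LeaveShape u = Σ (Fin n) λ γ → Σ (Fin n) λ ε → (γ ∈ α ∷ β ∷ []) × (ε ∈ α ∷ β ∷ []) ×
    ((newPart γ ε ⊕ added (u ∷ [])) ≈G (oldPart ⊕ removed (u ∷ [])))

  LeaveShape-turn : ∀ u → LeaveShape u → LeaveShape (turn u)
  LeaveShape-turn (s , t) (γ , ε , γ∈ , ε∈ , eq) = γ , ε , γ∈ , ε∈ , λ u v →
    trans (cong (newPart γ ε u v +_) (cong (_+ 0) (+-comm (addedEdge t u v) _)))
      (trans (eq u v) (cong (oldPart u v +_) (cong (_+ 0) (+-comm (removedEdge s u v) _))))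

  shape-pq : LeaveShape ((pos , p) , (pos , q))
  shape-pq = α , α , here refl , here refl , eq
    where
    regroup : ∀ ap ax aq bp bq → (((ap + ax) + ax) + aq) + ((bp + bq) + 0) ≡ (((bp + bq) + ax) + ax) + ((ap + aq) + 0)
    regroup = solve-∀
    eq : (newPart α α ⊕ added (((pos , p) , (pos , q)) ∷ [])) ≈G (oldPart ⊕ removed (((pos , p) , (pos , q)) ∷ []))
    eq u v = begin
      (((e p α + e α x) + e x α) + e α q) + ((e β p + e β q) + 0)
        ≡⟨ cong₂ (λ a b → (((a + e α x) + b) + e α q) + ((e β p + e β q) + 0)) (edgeG-comm p α u v) (edgeG-comm x α u v) ⟩
      (((e α p + e α x) + e α x) + e α q) + ((e β p + e β q) + 0)
        ≡⟨ regroup (e α p) (e α x) (e α q) (e β p) (e β q) ⟩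
      (((e β p + e β q) + e α x) + e α x) + ((e α p + e α q) + 0)
        ≡⟨ cong₂ (λ a b → (((a + e β q) + b) + e α x) + ((e α p + e α q) + 0)) (edgeG-comm p β u v) (edgeG-comm x α u v) ⟨
      (((e p β + e β q) + e x α) + e α x) + ((e α p + e α q) + 0) ∎
      where
      open ≡-Reasoning
      e : Fin n → Fin n → ℕ
      e a b = edgeG a b u v

  shape-xx : LeaveShape ((neg , x) , (neg , x))
  shape-xx = β , β , there (here refl) , there (here refl) , eq
    where
    regroup : ∀ pb bx bq ax → (((pb + bx) + bx) + bq) + ((ax + ax) + 0) ≡ (((pb + bq) + ax) + ax) + ((bx + bx) + 0)
    regroup = solve-∀
    eq : (newPart β β ⊕ added (((neg , x) , (neg , x)) ∷ [])) ≈G (oldPart ⊕ removed (((neg , x) , (neg , x)) ∷ []))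
    eq u v = begin
      (((e p β + e β x) + e x β) + e β q) + ((e α x + e α x) + 0)
        ≡⟨ cong (λ a → (((e p β + e β x) + a) + e β q) + ((e α x + e α x) + 0)) (edgeG-comm x β u v) ⟩
      (((e p β + e β x) + e β x) + e β q) + ((e α x + e α x) + 0)
        ≡⟨ regroup (e p β) (e β x) (e β q) (e α x) ⟩
      (((e p β + e β q) + e α x) + e α x) + ((e β x + e β x) + 0)
        ≡⟨ cong (λ a → (((e p β + e β q) + a) + e α x) + ((e β x + e β x) + 0)) (edgeG-comm x α u v) ⟨
      (((e p β + e β q) + e x α) + e α x) + ((e β x + e β x) + 0) ∎
      where
      open ≡-Reasoning
      e : Fin n → Fin n → ℕ
      e a b = edgeG a b u v

  shape-px : LeaveShape ((pos , p) , (neg , x))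
  shape-px = β , α , there (here refl) , here refl , eq
    where
    regroup : ∀ ap ax bx bq bp → (((ap + ax) + bx) + bq) + ((bp + ax) + 0) ≡ (((bp + bq) + ax) + ax) + ((ap + bx) + 0)
    regroup = solve-∀
    eq : (newPart β α ⊕ added (((pos , p) , (neg , x)) ∷ [])) ≈G (oldPart ⊕ removed (((pos , p) , (neg , x)) ∷ []))
    eq u v = begin
      (((e p α + e α x) + e x β) + e β q) + ((e β p + e α x) + 0)
        ≡⟨ cong₂ (λ a b → (((a + e α x) + b) + e β q) + ((e β p + e α x) + 0)) (edgeG-comm p α u v) (edgeG-comm x β u v) ⟩
      (((e α p + e α x) + e β x) + e β q) + ((e β p + e α x) + 0)
        ≡⟨ regroup (e α p) (e α x) (e β x) (e β q) (e β p) ⟩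
      (((e β p + e β q) + e α x) + e α x) + ((e α p + e β x) + 0)
        ≡⟨ cong₂ (λ a b → (((a + e β q) + b) + e α x) + ((e α p + e β x) + 0)) (edgeG-comm p β u v) (edgeG-comm x α u v) ⟨
      (((e p β + e β q) + e x α) + e α x) + ((e α p + e β x) + 0) ∎
      where
      open ≡-Reasoning
      e : Fin n → Fin n → ℕ
      e a b = edgeG a b u v

  shape-qx : LeaveShape ((pos , q) , (neg , x))
  shape-qx = α , β , here refl , there (here refl) , λ u v →
    regroup (edgeG p β u v) (edgeG β x u v) (edgeG x α u v) (edgeG α q u v) (edgeG β q u v) (edgeG α x u v)
    where
    regroup : ∀ pb bx xa aq bq ax → (((pb + bx) + xa) + aq) + ((bq + ax) + 0) ≡ (((pb + bq) + xa) + ax) + ((aq + bx) + 0)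
    regroup = solve-∀

  limit : Sign → Fin n → ℕ
  limit pos = tp
  limit neg = tm

  bounded-limit : ∀ {u} → Bounded tp tm u → ∀ σ w → switchDeg σ w u ≤ limit σ w
  bounded-limit bounded pos w = proj₁ (bounded w)
  bounded-limit bounded neg w = proj₂ (bounded w)

  endDeg-self : ∀ σ (a : Fin n) → endDeg σ a (σ , a) ≡ 1
  endDeg-self pos a = δ-refl a
  endDeg-self neg a = δ-refl a

  at-first : ∀ {σ a t} → Bounded tp tm ((σ , a) , t) → 1 ≤ limit σ a
  at-first {σ} {a} {t} bounded =
    ≤-trans (subst (λ k → 1 ≤ k + endDeg σ a t) (sym (endDeg-self σ a)) (s≤s z≤n)) (bounded-limit {(σ , a) , t} bounded σ a)

  at-second : ∀ {s σ a} → Bounded tp tm (s , (σ , a)) → 1 ≤ limit σ a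
  at-second {s} {σ} {a} bounded =
    ≤-trans (subst (λ k → 1 ≤ endDeg σ a s + k) (sym (endDeg-self σ a)) (m≤n+m 1 _)) (bounded-limit {s , (σ , a)} bounded σ a)

  end-pos : ∀ {a} → 1 ≤ tp a → (a ≡ p) ⊎ (a ≡ q)
  end-pos {a} 1≤ with p ≟ a | q ≟ a
  ... | yes refl | _ = inj₁ refl
  ... | no _ | yes refl = inj₂ refl
  end-pos {a} () | no _ | no _

  end-neg : ∀ {a} → 1 ≤ tm a → a ≡ x
  end-neg {a} 1≤ with x ≟ a
  ... | yes refl = refl
  end-neg {a} () | no _

  not-twice : ∀ {c} → (c ≡ p) ⊎ (c ≡ q) → ¬ (δ c c + δ c c ≤ tp c)
  not-twice (inj₁ refl) twice with subst₂ _≤_ (cong₂ _+_ (δ-refl p) (δ-refl p)) (cong₂ _+_ (δ-refl p) (δ-≢ (p≢q ∘ sym))) twice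
  ... | s≤s ()
  not-twice (inj₂ refl) twice with subst₂ _≤_ (cong₂ _+_ (δ-refl q) (δ-refl q)) (cong₂ _+_ (δ-≢ p≢q) (δ-refl q)) twice
  ... | s≤s ()

  shape : ∀ u → Bounded tp tm u → AvoidsPair u × LeaveShape u
  shape ((pos , a) , (pos , b)) bounded with end-pos (at-first {pos} {a} {pos , b} bounded) | end-pos (at-second {pos , a} {pos} {b} bounded)
  ... | inj₁ refl | inj₁ refl = contradiction (proj₁ (bounded p)) (not-twice (inj₁ refl))
  ... | inj₁ refl | inj₂ refl = (p-avoids , q-avoids) , shape-pq
  ... | inj₂ refl | inj₁ refl = (q-avoids , p-avoids) , LeaveShape-turn ((pos , p) , (pos , q)) shape-pq
  ... | inj₂ refl | inj₂ refl = contradiction (proj₁ (bounded q)) (not-twice (inj₂ refl))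
  shape ((neg , a) , (neg , b)) bounded with end-neg (at-first {neg} {a} {neg , b} bounded) | end-neg (at-second {neg , a} {neg} {b} bounded)
  ... | refl | refl = (x-avoids , x-avoids) , shape-xx
  shape ((pos , a) , (neg , b)) bounded with end-pos (at-first {pos} {a} {neg , b} bounded) | end-neg (at-second {pos , a} {neg} {b} bounded)
  ... | inj₁ refl | refl = (p-avoids , x-avoids) , shape-px
  ... | inj₂ refl | refl = (q-avoids , x-avoids) , shape-qx
  shape ((neg , a) , (pos , b)) bounded with end-neg (at-first {neg} {a} {pos , b} bounded) | end-pos (at-second {neg , a} {pos} {b} bounded)
  ... | refl | inj₁ refl = (x-avoids , p-avoids) , LeaveShape-turn ((pos , p) , (neg , x)) shape-px
  ... | refl | inj₂ refl = (x-avoids , q-avoids) , LeaveShape-turn ((pos , q) , (neg , x)) shape-qx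

  switchesDeg-at-pair : ∀ us → All AvoidsPair us → ∀ σ ρ → switchesDeg σ (vertexOf ρ) us ≡ 0
  switchesDeg-at-pair [] [] σ ρ = refl
  switchesDeg-at-pair ((s , t) ∷ us) ((s-avoids , t-avoids) ∷ avoiding) σ ρ =
    cong₂ _+_ (cong₂ _+_ (endDeg-off σ s s-avoids) (endDeg-off σ t t-avoids)) (switchesDeg-at-pair us avoiding σ ρ)
    where
    endDeg-off : ∀ σ e → Avoids (proj₂ e) → endDeg σ (vertexOf ρ) e ≡ 0
    endDeg-off pos (pos , a) a-avoids = δ-≢ (avoids-vertex a-avoids ρ)
    endDeg-off pos (neg , a) a-avoids = refl
    endDeg-off neg (pos , a) a-avoids = refl
    endDeg-off neg (neg , a) a-avoids = δ-≢ (avoids-vertex a-avoids ρ)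

  transfer : ∀ D⁺ D⁻ Gα Gβ T T′ → D⁺ + Gβ ≡ D⁻ + Gα → Gα + T ≡ Gβ + T′ → D⁺ + T ≡ D⁻ + T′
  transfer D⁺ D⁻ Gα Gβ T T′ e₁ e₂ = +-cancelʳ-≡ (Gα + Gβ) _ _ (begin
    (D⁺ + T) + (Gα + Gβ)     ≡⟨ shuffle D⁺ T Gα Gβ ⟩
    (D⁺ + Gβ) + (Gα + T)     ≡⟨ cong₂ _+_ e₁ e₂ ⟩
    (D⁻ + Gα) + (Gβ + T′)    ≡⟨ shuffle′ D⁻ T′ Gα Gβ ⟩
    (D⁻ + T′) + (Gα + Gβ)    ∎)
    where
    open ≡-Reasoning
    shuffle : ∀ a b c d → (a + b) + (c + d) ≡ (a + d) + (c + b)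
    shuffle = solve-∀
    shuffle′ : ∀ a b c d → (a + c) + (d + b) ≡ (a + b) + (c + d)
    shuffle′ = solve-∀

  settle : ∀ G′ G N O R A r a → G′ + R ≡ G + A → A + r ≡ R + a → N + a ≡ O + r → G′ + N ≡ G + O
  settle G′ G N O R A r a e₁ e₂ e₃ = +-cancelʳ-≡ (R + a) _ _ (begin
    (G′ + N) + (R + a)     ≡⟨ interchange G′ N R a ⟩
    (G′ + R) + (N + a)     ≡⟨ cong₂ _+_ e₁ e₃ ⟩
    (G + A) + (O + r)      ≡⟨ interchange G A O r ⟩
    (G + O) + (A + r)      ≡⟨ cong ((G + O) +_) e₂ ⟩
    (G + O) + (R + a)      ∎)
    where open ≡-Reasoning

  open Switching

  switch-leave : ∀ {lam} cs es → All IsCycle cs → MatchingPart lam n es →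
    (∀ w → Avoids w → (cyclesG cs α w + edgesG es α w) + tm w ≡ (cyclesG cs β w + edgesG es β w) + tp w) →
    Σ (List (List (Fin n))) λ cs′ → Σ (List (Fin n × Fin n)) λ es′ → Σ (Fin n) λ γ → Σ (Fin n) λ ε →
      CycleList (map length cs) cs′ × MatchingPart lam n es′ × (γ ∈ α ∷ β ∷ []) × (ε ∈ α ∷ β ∷ []) ×
      (((cyclesG cs′ ⊕ edgesG es′) ⊕ newPart γ ε) ≈G ((cyclesG cs ⊕ edgesG es) ⊕ oldPart))
  switch-leave {lam} cs es areCycles part leave-rows =
    let (m , u , telescopes , bounded) = bounded-selection (switches S) tp tm total unbalanced
        (u-avoids , γ , ε , γ∈ , ε∈ , leave-eq) = shape u bounded
        selected = select m (switches S)
    in proj₁ (switch S m) , proj₂ (switch S m) , γ , ε , proj₁ (admissible S m) , proj₂ (admissible S m) , γ∈ , ε∈ ,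
       λ v w → settle _ _ (newPart γ ε v w) (oldPart v w) (removed selected v w) (added selected v w)
                 (removed (u ∷ []) v w) (added (u ∷ []) v w)
                 (switched S m v w) (net-effect selected u (select-All m (avoiding S)) u-avoids telescopes v w) (leave-eq v w)
    where
    S : Switching (λ c → cyclesG (proj₁ c) ⊕ edgesG (proj₂ c)) (λ c → CycleList (map length cs) (proj₁ c) × MatchingPart lam n (proj₂ c)) (cs , es)
    S = combine (cyclesSwitching cs areCycles) (matchingSwitching es part)

    zero-at : ∀ {a} → Avoids a → ∀ ρ → δ a (vertexOf ρ) ≡ 0
    zero-at a-avoids ρ = δ-≢ (avoids-vertex a-avoids ρ)

    at-pair : ∀ ρ → switchesDeg pos (vertexOf ρ) (switches S) + tm (vertexOf ρ) ≡ switchesDeg neg (vertexOf ρ) (switches S) + tp (vertexOf ρ)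
    at-pair ρ = trans (cong₂ _+_ (switchesDeg-at-pair (switches S) (avoiding S) pos ρ) (cong₂ _+_ (zero-at x-avoids ρ) (zero-at x-avoids ρ)))
                  (sym (cong₂ _+_ (switchesDeg-at-pair (switches S) (avoiding S) neg ρ) (cong₂ _+_ (zero-at p-avoids ρ) (zero-at q-avoids ρ))))

    total : ∀ w → switchesDeg pos w (switches S) + tm w ≡ switchesDeg neg w (switches S) + tp w
    total w with w ≟ α | w ≟ β
    ... | yes refl | _ = at-pair pos
    ... | no _ | yes refl = at-pair neg
    ... | no w≢α | no w≢β = transfer (switchesDeg pos w (switches S)) (switchesDeg neg w (switches S))
                               (cyclesG cs α w + edgesG es α w) (cyclesG cs β w + edgesG es β w) (tm w) (tp w)
                               (balanced S w (w≢α , w≢β)) (leave-rows w (w≢α , w≢β))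

    unbalanced : ∃ λ w → tp w ≢ tm w
    unbalanced = x , λ tp≡tm → 0≢1+n (trans (sym (cong₂ _+_ (δ-≢ (x≢p ∘ sym)) (δ-≢ (x≢q ∘ sym)))) (trans tp≡tm (cong₂ _+_ (δ-refl x) (δ-refl x))))

-- Packings and flowers

packing-complement : ∀ {lam n M} (P : Packing lam n M) → (Packing.G P ⊕ leave P) ≈G complete lam n
packing-complement P u v = m+[n∸m]≡n (Packing.subgraph P u v)

complete-off : ∀ {lam n} {u v : Fin n} → u ≢ v → complete lam n u v ≡ lam
complete-off {u = u} {v} u≢v with u ≟ v
... | yes u≡v = contradiction u≡v u≢v
... | no _ = refl

record Decomposition (lam n : ℕ) (M : List ℕ) (G : Graph n) : Set where
  field
    cycles     : List (List (Fin n))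
    matched    : List (Fin n × Fin n)
    cycleList  : CycleList M cycles
    part       : MatchingPart lam n matched
    decomposes : G ≈G (cyclesG cycles ⊕ edgesG matched)

decomposition : ∀ {lam n M} (P : Packing lam n M) → Decomposition lam n M (Packing.G P)
decomposition {lam} {n} P with 2 ∣? lam * (n ∸ 1)
... | yes even with proj₁ (Packing.parity P) even
...   | _ , cs , cycleList , G≈ =
        record { cycles = cs ; matched = [] ; cycleList = cycleList ; part = none even refl
               ; decomposes = λ u v → trans (G≈ u v) (sym (+-identityʳ _)) }
decomposition {lam} {n} P | no odd with proj₂ (Packing.parity P) odd
...   | _ , cs , es , cycleList , pm , G≈ =
        record { cycles = cs ; matched = es ; cycleList = cycleList ; part = matching odd pm ; decomposes = G≈ }

packing-from : ∀ {lam n M} (cs : List (List (Fin n))) (es : List (Fin n × Fin n)) → CycleList M cs → MatchingPart lam n es →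
  (L : Graph n) → ((cyclesG cs ⊕ edgesG es) ⊕ L) ≈G complete lam n → Σ (Packing lam n M) λ P → leave P ≈G L
packing-from {lam} {n} {M} cs es cycleList part L complement = P , leave≈
  where
  G : Graph n
  G = cyclesG cs ⊕ edgesG es
  deg-G : ∀ u → deg G u ≡ deg (cyclesG cs) u + deg (edgesG es) u
  deg-G = deg-⊕ (cyclesG cs) (edgesG es)
  even-part : MatchingPart lam n es → 2 ∣ lam * (n ∸ 1) → (∀ u → 2 ∣ deg G u) × EvenDecomposition M G
  even-part (none _ refl) even =
        (λ u → subst (2 ∣_) (sym (trans (deg-G u) (trans (cong (deg (cyclesG cs) u +_) (sumFin-0 {n})) (+-identityʳ _))))
                 (cyclesG-even cs (proj₁ cycleList) u))
        , cs , cycleList , (λ u v → +-identityʳ _)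
  even-part (matching odd _) even = contradiction even odd
  odd-part : MatchingPart lam n es → ¬ (2 ∣ lam * (n ∸ 1)) → (∀ u → ¬ (2 ∣ deg G u)) × OddDecomposition M G
  odd-part (none even _) odd = contradiction even odd
  odd-part (matching _ pm@(_ , deg≡1)) odd =
        (λ u 2∣ → contradiction (∣1⇒≡1 (∣m+n∣m⇒∣n (subst (2 ∣_) (trans (deg-G u) (cong (_ +_) (deg≡1 u))) 2∣) (cyclesG-even cs (proj₁ cycleList) u))) λ ())
        , cs , es , cycleList , pm , (λ u v → refl)
  P : Packing lam n M
  P = record { G = G ; subgraph = λ u v → ≤-trans (m≤m+n (G u v) (L u v)) (≤-reflexive (complement u v)) ; parity = even-part part , odd-part part }
  leave≈ : leave P ≈G L
  leave≈ u v = trans (cong (_∸ G u v) (sym (complement u v))) (m+n∸m≡n (G u v) (L u v))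

MeetOnlyAt : ∀ {n} → Fin n → List (Fin n) → List (Fin n) → Set
MeetOnlyAt x A B = ∀ y → ((y ∈ A × y ∈ B) ⇔ (y ≡ x))

meet-centre : ∀ {n} {x : Fin n} {A B} → MeetOnlyAt x A B → (x ∈ A) × (x ∈ B)
meet-centre meet = Equivalence.from (meet _) refl

meet-only : ∀ {n} {x y : Fin n} {A B} → MeetOnlyAt x A B → y ∈ A → y ∈ B → y ≡ x
meet-only meet y∈A y∈B = Equivalence.to (meet _) (y∈A , y∈B)

record Petals {n : ℕ} (M′ : List ℕ) (x : Fin n) (As : List (List (Fin n))) : Set where
  field
    are-cycles : All IsCycle As
    lengths    : map length As ≡ M′
    meet       : AllPairs (MeetOnlyAt x) As

add-petal : ∀ {n} {M′} {x : Fin n} {As} → Petals M′ x As → (C : List (Fin n)) → IsCycle C → All (λ A → MeetOnlyAt x A C) As →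
  IsFlowerG (M′ ++ length C ∷ []) (cyclesG (As ++ C ∷ []))
add-petal {M′ = M′} {x} {As} petals C isCycle meets =
  subst (1 ≤_) (sym (trans (length-++ M′) (+-comm (length M′) 1))) (s≤s z≤n) ,
  As ++ C ∷ [] ,
  (++⁺ (Petals.are-cycles petals) (isCycle ∷ []) , λ _ → x , AllPairs.++⁺ (Petals.meet petals) ([] ∷ []) (All.map (_∷ []) meets)) ,
  trans (map-++ length As (C ∷ [])) (cong (_++ length C ∷ []) (Petals.lengths petals)) ,
  λ u v → refl

IsFlowerG-≈ : ∀ {n} (a : List ℕ) {H K : Graph n} → H ≈G K → IsFlowerG a K → IsFlowerG a H
IsFlowerG-≈ a H≈K (nonempty , As , flower , lengths , K≈) = nonempty , As , flower , lengths , λ u v → trans (H≈K u v) (K≈ u v)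

cyclesG-++ : ∀ {n} (cs ds : List (List (Fin n))) → cyclesG (cs ++ ds) ≈G (cyclesG cs ⊕ cyclesG ds)
cyclesG-++ [] ds u v = refl
cyclesG-++ (c ∷ cs) ds u v = trans (cong (cycleG c u v +_) (cyclesG-++ cs ds u v)) (sym (+-assoc (cycleG c u v) _ _))

CycleList-snoc : ∀ {n} {M} {cs : List (List (Fin n))} {C} → CycleList M cs → IsCycle C → CycleList (M ++ length C ∷ []) (cs ++ C ∷ [])
CycleList-snoc {cs = cs} {C} (areCycles , lengths) isCycle =
  ++⁺ areCycles (isCycle ∷ []) , trans (map-++ length cs (C ∷ [])) (cong (_++ length C ∷ []) lengths)

map-split : ∀ {A B : Set} (f : A → B) (l : List A) (xs ys : List B) → map f l ≡ xs ++ ys →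
  Σ (List A) λ l₁ → Σ (List A) λ l₂ → (l ≡ l₁ ++ l₂) × (map f l₁ ≡ xs) × (map f l₂ ≡ ys)
map-split f l [] ys eq = [] , l , refl , refl , eq
map-split f (a ∷ l) (b ∷ xs) ys eq with ∷-injective eq
... | fa≡b , eq′ with map-split f l xs ys eq′
...   | l₁ , l₂ , refl , eq₁ , eq₂ = a ∷ l₁ , l₂ , refl , cong₂ _∷_ fa≡b eq₁ , eq₂

AllPairs-++⁻ : ∀ {A : Set} {R : A → A → Set} (xs : List A) {ys} → AllPairs R (xs ++ ys) →
  AllPairs R xs × AllPairs R ys × All (λ a → All (R a) ys) xs
AllPairs-++⁻ [] pairs = [] , pairs , []
AllPairs-++⁻ (x ∷ xs) (x-rel ∷ pairs) with AllPairs-++⁻ xs pairs | ++⁻ xs x-rel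
... | xs-pairs , ys-pairs , across | x-xs , x-ys = (x-xs ∷ xs-pairs) , ys-pairs , (x-ys ∷ across)

record DigonFlower {n : ℕ} (M′ : List ℕ) (m : ℕ) (L : Graph n) : Set where
  field
    centre       : Fin n
    petals       : List (List (Fin n))
    cycle        : List (Fin n)
    digon        : List (Fin n)
    petals-ok    : Petals M′ centre petals
    cycle-ok     : IsCycle cycle
    digon-ok     : IsCycle digon
    cycle-length : length cycle ≡ m
    digon-length : length digon ≡ 2
    petal-cycle  : All (λ A → MeetOnlyAt centre A cycle) petals
    petal-digon  : All (λ A → MeetOnlyAt centre A digon) petals
    cycle-digon  : MeetOnlyAt centre cycle digon
    decomposes   : L ≈G (cyclesG petals ⊕ (cycleG cycle ⊕ (cycleG digon ⊕ emptyG)))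

digonFlower : ∀ {n} M′ m (L : Graph n) → IsFlowerG (M′ ++ m ∷ 2 ∷ []) L → DigonFlower M′ m L
digonFlower M′ m L (_ , As′ , (areCycles , centred) , lengths , L≈) with map-split length As′ M′ (m ∷ 2 ∷ []) lengths
... | As , C ∷ D ∷ [] , refl , As-lengths , CD-lengths with centred (subst (2 ≤_) (sym (length-++ As)) (m≤n+m 2 (length As)))
...   | x , meets with AllPairs-++⁻ As meets | ++⁻ As areCycles
...     | As-meet , ((C-D ∷ []) ∷ [] ∷ []) , across | As-cycles , (C-cycle ∷ D-cycle ∷ []) = record
  { centre = x ; petals = As ; cycle = C ; digon = D
  ; petals-ok = record { are-cycles = As-cycles ; lengths = As-lengths ; meet = As-meet }
  ; cycle-ok = C-cycle ; digon-ok = D-cycle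
  ; cycle-length = proj₁ (∷-injective CD-lengths) ; digon-length = proj₁ (∷-injective (proj₂ (∷-injective CD-lengths)))
  ; petal-cycle = All.map (λ { (A-C ∷ _) → A-C }) across
  ; petal-digon = All.map (λ { (_ ∷ A-D ∷ []) → A-D }) across
  ; cycle-digon = C-D
  ; decomposes = λ u v → trans (L≈ u v) (cyclesG-++ As (C ∷ D ∷ []) u v)
  }
digonFlower M′ m L (_ , As′ , _ , lengths , _) | As , [] , refl , _ , ()
digonFlower M′ m L (_ , As′ , _ , lengths , _) | As , _ ∷ [] , refl , _ , ()
digonFlower M′ m L (_ , As′ , _ , lengths , _) | As , _ ∷ _ ∷ _ ∷ _ , refl , _ , ()

module Shortening {lam n : ℕ} {M M′ : List ℕ} {m : ℕ} (P : Packing lam n M) (F : DigonFlower M′ m (leave P)) where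

  open DigonFlower F renaming (centre to x; decomposes to leave≈)
  open Decomposition (decomposition P)
  open PermSetoid (setoid (Fin n)) using (Unique-resp-↭)

  Shortened : Set
  Shortened = Σ (Packing lam n (M ++ 3 ∷ [])) λ P′ → IsFlowerG (M′ ++ m ∸ 1 ∷ []) (leave P′)

  complement : ((cyclesG cycles ⊕ edgesG matched) ⊕ (cyclesG petals ⊕ (cycleG cycle ⊕ (cycleG digon ⊕ emptyG)))) ≈G complete lam n
  complement u v = trans (cong₂ _+_ (sym (decomposes u v)) (sym (leave≈ u v))) (packing-complement P u v)

  move-cycle : m ≡ 3 → Shortened
  move-cycle refl =
    let (P′ , leave′≈) = packing-from (cycles ++ cycle ∷ []) matched
                            (subst (λ k → CycleList (M ++ k ∷ []) (cycles ++ cycle ∷ [])) cycle-length (CycleList-snoc cycleList cycle-ok))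
                            part (cyclesG (petals ++ digon ∷ [])) complement′
    in P′ , IsFlowerG-≈ _ leave′≈ (subst (λ k → IsFlowerG (M′ ++ k ∷ []) (cyclesG (petals ++ digon ∷ []))) digon-length
                                     (add-petal petals-ok digon digon-ok petal-digon))
    where
    regroup : ∀ c e C D A → ((c + (C + 0)) + e) + (A + (D + 0)) ≡ (c + e) + (A + (C + (D + 0)))
    regroup = solve-∀
    complement′ : ((cyclesG (cycles ++ cycle ∷ []) ⊕ edgesG matched) ⊕ cyclesG (petals ++ digon ∷ [])) ≈G complete lam n
    complement′ u v =
      trans (cong₂ (λ a b → (a + edgesG matched u v) + b) (cyclesG-++ cycles (cycle ∷ []) u v) (cyclesG-++ petals (digon ∷ []) u v))
        (trans (regroup (cyclesG cycles u v) (edgesG matched u v) (cycleG cycle u v) (cycleG digon u v) (cyclesG petals u v))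
          (complement u v))

  module Switched (z p β q : Fin n) (R′ : List (Fin n))
                  (digon↭ : x ∷ z ∷ [] ↭ digon) (digon≈ : cycleG (x ∷ z ∷ []) ≈G cycleG digon)
                  (cycle↭ : x ∷ p ∷ β ∷ q ∷ R′ ↭ cycle) (cycle≈ : cycleG (x ∷ p ∷ β ∷ q ∷ R′) ≈G cycleG cycle) where

    C′-unique : Unique (x ∷ p ∷ β ∷ q ∷ R′)
    C′-unique = Unique-resp-↭ (↭⇒↭ₛ (↭-sym cycle↭)) (proj₂ cycle-ok)

    x≢ : All (x ≢_) (p ∷ β ∷ q ∷ R′)
    x≢ = AllPairs.head C′-unique

    p≢ : All (p ≢_) (β ∷ q ∷ R′)
    p≢ = AllPairs.head (AllPairs.tail C′-unique)

    β≢ : All (β ≢_) (q ∷ R′)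
    β≢ = AllPairs.head (AllPairs.tail (AllPairs.tail C′-unique))

    x≢z : x ≢ z
    x≢z = All.head (AllPairs.head (Unique-resp-↭ (↭⇒↭ₛ (↭-sym digon↭)) (proj₂ digon-ok)))

    in-cycle : ∀ {y} → y ∈ x ∷ p ∷ β ∷ q ∷ R′ → y ∈ cycle
    in-cycle = ∈-resp-↭ cycle↭

    z∈digon : z ∈ digon
    z∈digon = ∈-resp-↭ digon↭ (there (here refl))

    β∈cycle : β ∈ cycle
    β∈cycle = in-cycle (there (there (here refl)))

    z∉cycle : z ∉ cycle
    z∉cycle z∈ = x≢z (sym (meet-only cycle-digon z∈ z∈digon))

    z≢ : ∀ {y} → y ∈ cycle → z ≢ y
    z≢ y∈ refl = z∉cycle y∈

    β≢x : β ≢ x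
    β≢x = All.lookup x≢ (there (here refl)) ∘ sym

    distinct : Unique (z ∷ β ∷ x ∷ p ∷ q ∷ [])
    distinct =
      (z≢ β∈cycle ∷ x≢z ∘ sym ∷ z≢ (in-cycle (there (here refl))) ∷ z≢ (in-cycle (there (there (there (here refl))))) ∷ []) ∷
      (β≢x ∷ All.head p≢ ∘ sym ∷ All.head β≢ ∷ []) ∷
      (All.head x≢ ∷ All.lookup x≢ (there (there (here refl))) ∷ []) ∷
      (All.lookup p≢ (there (here refl)) ∷ []) ∷ [] ∷ []

    open LeaveSwitch z β x p q distinct using (switch-leave; tp; tm; newPart; oldPart)

    leave-at-z : ∀ w → leave P z w ≡ δ x w + δ x w
    leave-at-z w = begin
      leave P z w                                                      ≡⟨ leave≈ z w ⟩
      cyclesG petals z w + (cycleG cycle z w + (cycleG digon z w + 0))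
        ≡⟨ cong₂ (λ a b → a + (b + (cycleG digon z w + 0))) (cyclesG-off petals z∉petals w) (cycleG-off cycle z∉cycle w) ⟩
      cycleG digon z w + 0                                             ≡⟨ +-identityʳ _ ⟩
      cycleG digon z w                                                 ≡⟨ digon≈ z w ⟨
      cycleG (x ∷ z ∷ []) z w                                          ≡⟨ cycleG-rotate₁ x (z ∷ []) z w ⟩
      cycleG (z ∷ x ∷ []) z w                                          ≡⟨ cycleG-at {P = []} (λ { (here z≡x) → x≢z (sym z≡x) ; (there ()) }) w ⟩
      δ x w + δ x w                                                    ∎
      where
      open ≡-Reasoning
      z∉petals : All (z ∉_) petals
      z∉petals = All.map (λ meet z∈A → x≢z (sym (meet-only meet z∈A z∈digon))) petal-digon

    leave-at-β : ∀ w → leave P β w ≡ δ p w + δ q w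
    leave-at-β w = begin
      leave P β w                                                      ≡⟨ leave≈ β w ⟩
      cyclesG petals β w + (cycleG cycle β w + (cycleG digon β w + 0))
        ≡⟨ cong₂ (λ a b → a + (cycleG cycle β w + (b + 0))) (cyclesG-off petals β∉petals w) (cycleG-off digon β∉digon w) ⟩
      cycleG cycle β w + 0                                             ≡⟨ +-identityʳ _ ⟩
      cycleG cycle β w                                                 ≡⟨ cycle≈ β w ⟨
      cycleG ((x ∷ p ∷ []) ++ β ∷ q ∷ R′) β w                          ≡⟨ cycleG-rotate (x ∷ p ∷ []) (β ∷ q ∷ R′) β w ⟩
      cycleG (β ∷ q ∷ R′ ++ x ∷ p ∷ []) β w                            ≡⟨ cycleG-at (All¬⇒¬Any (++⁺ β≢ (β≢x ∷ All.head p≢ ∘ sym ∷ []))) w ⟩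
      δ q w + δ (lastOf q (R′ ++ x ∷ p ∷ [])) w                         ≡⟨ cong (λ a → δ q w + δ a w) (lastOf-++ q R′ x (p ∷ [])) ⟩
      δ q w + δ p w                                                    ≡⟨ +-comm (δ q w) _ ⟩
      δ p w + δ q w                                                    ∎
      where
      open ≡-Reasoning
      β∉petals : All (β ∉_) petals
      β∉petals = All.map (λ meet β∈A → β≢x (meet-only meet β∈A β∈cycle)) petal-cycle
      β∉digon : β ∉ digon
      β∉digon β∈ = β≢x (meet-only cycle-digon β∈cycle β∈)

    leave-rows : ∀ w → (w ≢ z) × (w ≢ β) →
      (cyclesG cycles z w + edgesG matched z w) + tm w ≡ (cyclesG cycles β w + edgesG matched β w) + tp w
    leave-rows w (w≢z , w≢β) = begin
      (cyclesG cycles z w + edgesG matched z w) + tm w   ≡⟨ cong₂ _+_ (decomposes z w) (leave-at-z w) ⟨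
      Packing.G P z w + leave P z w                      ≡⟨ packing-complement P z w ⟩
      complete lam n z w                                 ≡⟨ complete-off (w≢z ∘ sym) ⟩
      lam                                                ≡⟨ complete-off (w≢β ∘ sym) ⟨
      complete lam n β w                                 ≡⟨ packing-complement P β w ⟨
      Packing.G P β w + leave P β w                      ≡⟨ cong₂ _+_ (decomposes β w) (leave-at-β w) ⟩
      (cyclesG cycles β w + edgesG matched β w) + tp w   ∎
      where open ≡-Reasoning

    triangle : Fin n → List (Fin n)
    triangle ε = x ∷ p ∷ ε ∷ []

    petal′ : Fin n → List (Fin n)
    petal′ γ = x ∷ γ ∷ q ∷ R′

    triangle-ok : ∀ {ε} → ε ∈ z ∷ β ∷ [] → IsCycle (triangle ε)
    triangle-ok (here refl) = s≤s (s≤s z≤n) , (All.head x≢ ∷ x≢z ∷ []) ∷ (z≢ (in-cycle (there (here refl))) ∘ sym ∷ []) ∷ [] ∷ []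
    triangle-ok (there (here refl)) = s≤s (s≤s z≤n) , (All.head x≢ ∷ β≢x ∘ sym ∷ []) ∷ (All.head p≢ ∷ []) ∷ [] ∷ []

    petal′-ok : ∀ {γ} → γ ∈ z ∷ β ∷ [] → IsCycle (petal′ γ)
    petal′-ok {γ} γ∈ = s≤s (s≤s z≤n) , (x≢γ γ∈ ∷ All.tail (All.tail x≢)) ∷ γ≢ γ∈ ∷ AllPairs.tail (AllPairs.tail (AllPairs.tail C′-unique))
      where
      x≢γ : ∀ {γ} → γ ∈ z ∷ β ∷ [] → x ≢ γ
      x≢γ (here refl) = x≢z
      x≢γ (there (here refl)) = β≢x ∘ sym
      γ≢ : ∀ {γ} → γ ∈ z ∷ β ∷ [] → All (γ ≢_) (q ∷ R′)
      γ≢ (here refl) = All.tabulate (λ y∈ → z≢ (in-cycle (there (there (there y∈)))))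
      γ≢ (there (here refl)) = β≢

    petal′-length : ∀ γ → length (petal′ γ) ≡ m ∸ 1
    petal′-length γ = cong (_∸ 1) (trans (↭-length cycle↭) cycle-length)

    petal′-meets : ∀ {γ} → γ ∈ z ∷ β ∷ [] → All (λ A → MeetOnlyAt x A (petal′ γ)) petals
    petal′-meets {γ} γ∈ = All.zipWith (λ { (A-C , A-D) → meets A-C A-D }) (petal-cycle , petal-digon)
      where
      γ-only : ∀ {γ A y} → γ ∈ z ∷ β ∷ [] → MeetOnlyAt x A cycle → MeetOnlyAt x A digon → y ∈ A → y ≡ γ → y ≡ x
      γ-only (here refl) A-C A-D y∈A refl = meet-only A-D y∈A z∈digon
      γ-only (there (here refl)) A-C A-D y∈A refl = meet-only A-C y∈A β∈cycle
      meets : ∀ {A} → MeetOnlyAt x A cycle → MeetOnlyAt x A digon → MeetOnlyAt x A (petal′ γ)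
      meets {A} A-C A-D y = mk⇔ to from
        where
        to : (y ∈ A) × (y ∈ petal′ γ) → y ≡ x
        to (_ , here y≡x) = y≡x
        to (y∈A , there (here y≡γ)) = γ-only γ∈ A-C A-D y∈A y≡γ
        to (y∈A , there (there y∈)) = meet-only A-C y∈A (in-cycle (there (there (there y∈))))
        from : y ≡ x → (y ∈ A) × (y ∈ petal′ γ)
        from refl = proj₁ (meet-centre A-C) , here refl

    recombined : ∀ γ ε cs′ es′ → ((cyclesG cs′ ⊕ edgesG es′) ⊕ newPart γ ε) ≈G ((cyclesG cycles ⊕ edgesG matched) ⊕ oldPart) →
      ((cyclesG (cs′ ++ triangle ε ∷ []) ⊕ edgesG es′) ⊕ cyclesG (petals ++ petal′ γ ∷ [])) ≈G complete lam n
    recombined γ ε cs′ es′ switched≈ u v = begin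
      (cyclesG (cs′ ++ triangle ε ∷ []) u v + edgesG es′ u v) + cyclesG (petals ++ petal′ γ ∷ []) u v
        ≡⟨ cong₂ (λ a b → (a + edgesG es′ u v) + b) (cyclesG-++ cs′ _ u v) (cyclesG-++ petals _ u v) ⟩
      ((cyclesG cs′ u v + (cycleG (triangle ε) u v + 0)) + edgesG es′ u v) + (cyclesG petals u v + (cycleG (petal′ γ) u v + 0))
        ≡⟨ regroup₁ (cyclesG cs′ u v) (edgesG es′ u v) (e x p) (e p ε) (e ε x) (e x γ) (e γ q) (cyclesG petals u v) K ⟩
      ((cyclesG cs′ u v + edgesG es′ u v) + newPart γ ε u v) + ((e x p + cyclesG petals u v) + K)
        ≡⟨ cong (_+ ((e x p + cyclesG petals u v) + K)) (switched≈ u v) ⟩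
      ((cyclesG cycles u v + edgesG matched u v) + oldPart u v) + ((e x p + cyclesG petals u v) + K)
        ≡⟨ regroup₂ (cyclesG cycles u v) (edgesG matched u v) (e p β) (e β q) (e x z) (e z x) (e x p) (cyclesG petals u v) K ⟩
      (cyclesG cycles u v + edgesG matched u v) + (cyclesG petals u v + (cycleG (x ∷ p ∷ β ∷ q ∷ R′) u v + (cycleG (x ∷ z ∷ []) u v + 0)))
        ≡⟨ cong₂ (λ a b → (cyclesG cycles u v + edgesG matched u v) + (cyclesG petals u v + (a + (b + 0)))) (cycle≈ u v) (digon≈ u v) ⟩
      (cyclesG cycles u v + edgesG matched u v) + (cyclesG petals u v + (cycleG cycle u v + (cycleG digon u v + 0)))
        ≡⟨ complement u v ⟩
      complete lam n u v ∎
      where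
      open ≡-Reasoning
      e : Fin n → Fin n → ℕ
      e a b = edgeG a b u v
      K : ℕ
      K = edgesG (cycEdgesFrom x (q ∷ R′)) u v
      regroup₁ : ∀ c′ e′ xp pε εx xγ γq A K →
        ((c′ + ((xp + (pε + (εx + 0))) + 0)) + e′) + (A + ((xγ + (γq + K)) + 0)) ≡ ((c′ + e′) + (((pε + εx) + xγ) + γq)) + ((xp + A) + K)
      regroup₁ = solve-∀
      regroup₂ : ∀ c e pβ βq xz zx xp A K →
        ((c + e) + (((pβ + βq) + xz) + zx)) + ((xp + A) + K) ≡ (c + e) + (A + ((xp + (pβ + (βq + K))) + ((xz + (zx + 0)) + 0)))
      regroup₂ = solve-∀

    shortened : Shortened
    shortened =
      let (cs′ , es′ , γ , ε , cycleList′ , part′ , γ∈ , ε∈ , switched≈) = switch-leave cycles matched (proj₁ cycleList) part leave-rows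
          (P′ , leave′≈) = packing-from (cs′ ++ triangle ε ∷ []) es′
                             (CycleList-snoc (subst (λ M₀ → CycleList M₀ cs′) (proj₂ cycleList) cycleList′) (triangle-ok ε∈))
                             part′ (cyclesG (petals ++ petal′ γ ∷ [])) (recombined γ ε cs′ es′ switched≈)
      in P′ , IsFlowerG-≈ _ leave′≈ (subst (λ k → IsFlowerG (M′ ++ k ∷ []) (cyclesG (petals ++ petal′ γ ∷ []))) (petal′-length γ)
                                       (add-petal petals-ok (petal′ γ) (petal′-ok γ∈) (petal′-meets γ∈)))

  too-short : ∀ {k} → 4 ≤ m → k ≡ length cycle → k ≤ 3 → Shortened
  too-short 4≤m k≡ k≤3 = contradiction (≤-trans (subst (4 ≤_) (sym (trans k≡ cycle-length)) 4≤m) k≤3) λ { (s≤s (s≤s (s≤s ()))) }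

  switch-triangle : 4 ≤ m → Shortened
  switch-triangle 4≤m with rotateTo digon (proj₂ (meet-centre cycle-digon)) | rotateTo cycle (proj₁ (meet-centre cycle-digon))
  ... | z ∷ [] , digon↭ , digon≈ | p ∷ β ∷ q ∷ R′ , cycle↭ , cycle≈ = Switched.shortened z p β q R′ digon↭ digon≈ cycle↭ cycle≈
  ... | [] , digon↭ , _ | _ = contradiction (trans (↭-length digon↭) digon-length) λ ()
  ... | _ ∷ _ ∷ _ , digon↭ , _ | _ = contradiction (trans (↭-length digon↭) digon-length) λ ()
  ... | z ∷ [] , _ | [] , cycle↭ , _ = too-short 4≤m (↭-length cycle↭) (s≤s z≤n)
  ... | z ∷ [] , _ | _ ∷ [] , cycle↭ , _ = too-short 4≤m (↭-length cycle↭) (s≤s (s≤s z≤n))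
  ... | z ∷ [] , _ | _ ∷ _ ∷ [] , cycle↭ , _ = too-short 4≤m (↭-length cycle↭) (s≤s (s≤s (s≤s z≤n)))

lemma3p4 : (M M' : List ℕ) (lam n m : ℕ) →
    All (2 ≤_) M → All (2 ≤_) M' →
    1 ≤ lam → 1 ≤ n → 3 ≤ m →
    Σ (Packing lam n M) (λ P →
      OnlyNontrivialComponentIsFlower (M' ++ (m ∷ 2 ∷ [])) (leave P)) →
    Σ (Packing lam n (M ++ (3 ∷ []))) (λ P →
      OnlyNontrivialComponentIsFlower (M' ++ (m ∸ 1 ∷ [])) (leave P))
-- The bounds on the entries of M, M' and on lam, n are not needed.
lemma3p4 M M' lam n m _ _ _ _ 3≤m (P , flower) with m≤n⇒m<n∨m≡n 3≤m
... | inj₁ 4≤m = Shortening.switch-triangle P (digonFlower M' m (leave P) flower) 4≤m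
... | inj₂ 3≡m = Shortening.move-cycle P (digonFlower M' m (leave P) flower) (sym 3≡m)
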